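{- If all vertices of a finite simple graph $G$ have even degree, then $\mathrm{Maj}'(G)\le 4$. Moreover, if in addition $G$ is connected and its number of edges $|E(G)|$ satisfies $|E(G)|\equiv 0 \pmod 3$, then $\mathrm{Maj}'(G)\le 3$.
   Context: Two distinct edges are adjacent if they share an endpoint. An edge-coloring $c:E\to C$ (not necessarily proper) of a graph $G=(V,E)$ is a strong majority edge-coloring if for every edge $e\in E$ and every color $\alpha\in C$, at most half of the edges adjacent to $e$ have color $\alpha$. The strong majority index $\mathrm{Maj}'(G)$ is the least number of colors in such a coloring. -}

module Defs where

open import Data.Nat using (ℕ; zero; suc; _+_; _*_; _≤_; _<ᵇ_)
open import Data.Nat.Divisibility using (_∣_)
open import Data.Bool using (Bool; true; false; _∧_; _∨_; not; if_then_else_)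
open import Data.Fin using (Fin; toℕ; _≟_)
import Data.Fin as F
open import Data.Product using (∃)
open import Relation.Nullary.Decidable using (⌊_⌋)
open import Relation.Binary.PropositionalEquality using (_≡_)

record SimpleGraph (n : ℕ) : Set where
  field
    Adj      : Fin n → Fin n → Bool
    sym      : ∀ u v → Adj u v ≡ Adj v u
    loopless : ∀ v → Adj v v ≡ false
open SimpleGraph public

sumFin : ∀ {n} → (Fin n → ℕ) → ℕ
sumFin {zero}  f = 0
sumFin {suc n} f = f F.zero + sumFin (λ i → f (F.suc i))

count : ∀ {n} → (Fin n → Bool) → ℕ
count p = sumFin (λ i → if p i then 1 else 0)

count₂ : ∀ {n} → (Fin n → Fin n → Bool) → ℕ
count₂ p = sumFin (λ a → count (p a))

_==_ : ∀ {n} → Fin n → Fin n → Bool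
a == b = ⌊ a ≟ b ⌋

module _ {n : ℕ} (G : SimpleGraph n) where

  degree : Fin n → ℕ
  degree v = count (Adj G v)

  -- Each edge {a , b} is represented exactly once, by the ordered pair
  -- (a , b) with a < b.
  isEdge : Fin n → Fin n → Bool
  isEdge a b = (toℕ a <ᵇ toℕ b) ∧ Adj G a b

  numEdges : ℕ
  numEdges = count₂ isEdge

  adjacentEdges : Fin n → Fin n → Fin n → Fin n → Bool
  adjacentEdges a b c d =
    isEdge c d
    ∧ not ((a == c) ∧ (b == d))
    ∧ ((a == c) ∨ (a == d) ∨ (b == c) ∨ (b == d))

  numAdjacent : Fin n → Fin n → ℕ
  numAdjacent a b = count₂ (adjacentEdges a b)

  -- An edge-colouring with colour set Fin k: the colour of edge {a , b}
  -- (a < b) is c a b; values on non-edges are irrelevant.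
  EdgeColoring : ℕ → Set
  EdgeColoring k = Fin n → Fin n → Fin k

  numAdjacentColored : ∀ {k} → EdgeColoring k → Fin n → Fin n → Fin k → ℕ
  numAdjacentColored c a b α =
    count₂ (λ x y → adjacentEdges a b x y ∧ (c x y == α))

  IsStrongMajority : ∀ {k} → EdgeColoring k → Set
  IsStrongMajority {k} c =
    ∀ a b → isEdge a b ≡ true → ∀ (α : Fin k) →
      2 * numAdjacentColored c a b α ≤ numAdjacent a b

  MajIndex≤ : ℕ → Set
  MajIndex≤ k = ∃ λ (c : EdgeColoring k) → IsStrongMajority c

  AllDegreesEven : Set
  AllDegreesEven = ∀ v → 2 ∣ degree v

  data Reachable : Fin n → Fin n → Set where
    here : ∀ {u} → Reachable u u
    step : ∀ {u w v} → Adj G u w ≡ true → Reachable w v → Reachable u v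

  Connected : Set
  Connected = ∀ u v → Reachable u v

-- Hierholzer's algorithm splits the edges of an even graph into circuits each of which contains every edge
-- at each of its vertices (one Euler circuit per component). Consecutive edges of a circuit pair up the
-- edges at every vertex. Colour the edges e₁ … e_L of each circuit so that cᵢ ≠ cᵢ₊₁ and cᵢ₋₁ ≠ cᵢ₊₁
-- (indices mod L). For an edge e = ab with partners pₐ at a and p_b at b, the edges at a other than e and pₐ
-- form pairs of distinct colours, so at most (deg a − 2)/2 + [c(pₐ) = α] edges at a other than e have
-- colour α, and likewise at b. As c(pₐ) ≠ c(p_b), at most half of the deg a + deg b − 2 edges adjacent to e
-- have colour α. Concatenating the colour blocks 012 and 0123 handles every circuit length L ≥ 3 except 5,
-- with three colours when 3 ∣ L; a connected even graph has a single circuit, of length |E(G)|. A circuit of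
-- length 5 is a 5-cycle, whose vertices have degree 2 and so only need cᵢ₋₁ ≠ cᵢ₊₁: 0 1 1 2 3 works there.

module Submission where

open import Defs renaming (sym to Adj-sym)
open import Data.Bool using (Bool; true; false; _∧_; not; if_then_else_)
open import Data.Bool.Properties using (∧-identityʳ; ∧-zeroʳ; ∧-conicalˡ; ∧-conicalʳ) renaming (_≟_ to _≟ᵇ_)
open import Data.Fin using (Fin; zero; suc; toℕ; _≟_)
open import Data.Fin.Patterns using (0F; 1F; 2F; 3F)
open import Data.Fin.Permutation using (permutation)
open import Data.Fin.Properties using (toℕ-injective; any?)
open import Data.List using (List; []; _∷_; _++_; [_]; _∷ʳ_; length; map; zip; concatMap; replicate; initLast; _∷ʳ′_)
open import Data.List.Properties using (++-assoc; ++-identityʳ; length-++; map-++; map-∘; map-concatMap)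
open import Data.List.Membership.Propositional using (_∈_; find)
open import Data.List.Membership.Propositional.Properties using (∈-++⁻; ∈-++⁺ˡ; ∈-++⁺ʳ; ∈-∃++; ∈-AllPairs₂)
open import Data.List.Relation.Binary.Permutation.Propositional using (_↭_; ↭-sym; ↭-trans; ↭-reflexive; ↭⇒↭ₛ′)
import Data.List.Relation.Binary.Permutation.Propositional.Properties as ↭
import Data.List.Relation.Binary.Permutation.Setoid.Properties as Perm
open import Data.List.Relation.Unary.All using (All; []; _∷_)
import Data.List.Relation.Unary.All as All
import Data.List.Relation.Unary.All.Properties as AllP
open import Data.List.Relation.Unary.AllPairs using (AllPairs; []; _∷_)
import Data.List.Relation.Unary.AllPairs.Properties as AllPairs
open import Data.List.Relation.Unary.Any as Any using (Any; here; there)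
import Data.List.Relation.Unary.Any.Properties as AnyP
open import Data.List.Relation.Unary.Linked using (Linked; []; [-]; _∷_)
open import Data.Nat using (ℕ; zero; suc; _+_; _*_; _<_; _≤_; _<ᵇ_; z≤n; s≤s)
open import Data.Nat.DivMod using (_/_; m/n*n≡m)
open import Data.Nat.Divisibility using (_∣_; ∣m+n∣m⇒∣n; ∣m∣n⇒∣m+n; m∣m*n; ∣1⇒≡1)
open import Data.Nat.Induction using (<-wellFounded)
open import Data.Nat.Properties
  using (+-0-commutativeMonoid; +-identityʳ; +-comm; +-assoc; suc-injective; m<m+n; *-cancelˡ-≡;
         ≤-refl; ≤-reflexive; ≤-trans; +-mono-≤; +-monoʳ-≤; *-monoʳ-≤; +-cancelʳ-≤; module ≤-Reasoning)
open import Data.Nat.Tactic.RingSolver using (solve-∀)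
open import Data.Product using (Σ; ∃; ∃₂; _×_; _,_; proj₁; proj₂; map₁; map₂) renaming (map to map×)
open import Data.Sum using (_⊎_; inj₁; inj₂)
import Data.Sum as Sum
open import Function using (_∘_)
open import Function.Bundles using (_⇔_; mk⇔)
open import Induction.WellFounded using (Acc; acc)
open import Level using (0ℓ)
open import Relation.Binary using (Setoid; IsEquivalence; Decidable)
open import Relation.Binary.PropositionalEquality
  using (_≡_; _≢_; refl; sym; trans; cong; cong₂; subst; module ≡-Reasoning)
open import Relation.Nullary using (¬_; Dec; yes; no; does; contradiction; _×-dec_; _⊎-dec_)
open import Relation.Nullary.Decidable using (dec-true; dec-false; does-⇔; isYes≗does; toSum)
import Algebra.Properties.CommutativeMonoid.Sum +-0-commutativeMonoid as ∑


-- Sums and counts over Fin n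

𝟙 : Bool → ℕ
𝟙 b = if b then 1 else 0

true≢false : true ≢ false
true≢false ()

true-or-false : (b : Bool) → b ≡ true ⊎ b ≡ false
true-or-false true  = inj₁ refl
true-or-false false = inj₂ refl

≡-or-≢ : ∀ {n} (a b : Fin n) → a ≡ b ⊎ a ≢ b
≡-or-≢ a b = toSum (a ≟ b)

==-refl : ∀ {n} (a : Fin n) → (a == a) ≡ true
==-refl a with a ≟ a
... | yes _  = refl
... | no a≢a = contradiction refl a≢a

≢⇒==-false : ∀ {n} {a b : Fin n} → a ≢ b → (a == b) ≡ false
≢⇒==-false {a = a} {b} a≢b with a ≟ b
... | yes a≡b = contradiction a≡b a≢b
... | no _    = refl

𝟙-≢∧ : ∀ {n} {a w : Fin n} X → a ≢ w → 𝟙 ((a == w) ∧ X) ≡ 0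
𝟙-≢∧ X a≢w rewrite ≢⇒==-false a≢w = refl

sumFin≡sum : ∀ {n} (f : Fin n → ℕ) → sumFin f ≡ ∑.sum f
sumFin≡sum {zero}  f = refl
sumFin≡sum {suc n} f = cong (f Fin.zero +_) (sumFin≡sum (f ∘ Fin.suc))

sumFin-cong : ∀ {n} {f g : Fin n → ℕ} → (∀ i → f i ≡ g i) → sumFin f ≡ sumFin g
sumFin-cong {zero}  f≗g = refl
sumFin-cong {suc n} f≗g = cong₂ _+_ (f≗g Fin.zero) (sumFin-cong (f≗g ∘ Fin.suc))

sumFin-mono-≤ : ∀ {n} {f g : Fin n → ℕ} → (∀ i → f i ≤ g i) → sumFin f ≤ sumFin g
sumFin-mono-≤ {zero}  f≤g = z≤n
sumFin-mono-≤ {suc n} f≤g = +-mono-≤ (f≤g Fin.zero) (sumFin-mono-≤ (f≤g ∘ Fin.suc))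

sumFin-zero : ∀ {n} {f : Fin n → ℕ} → (∀ i → f i ≡ 0) → sumFin f ≡ 0
sumFin-zero {zero}  f≗0 = refl
sumFin-zero {suc n} f≗0 = cong₂ _+_ (f≗0 Fin.zero) (sumFin-zero (f≗0 ∘ Fin.suc))

sumFin-+ : ∀ {n} (f g : Fin n → ℕ) → sumFin (λ i → f i + g i) ≡ sumFin f + sumFin g
sumFin-+ f g = begin
  sumFin (λ i → f i + g i)   ≡⟨ sumFin≡sum (λ i → f i + g i) ⟩
  ∑.sum (λ i → f i + g i)    ≡⟨ ∑.∑-distrib-+ f g ⟩
  ∑.sum f + ∑.sum g          ≡⟨ sym (cong₂ _+_ (sumFin≡sum f) (sumFin≡sum g)) ⟩
  sumFin f + sumFin g        ∎
  where open ≡-Reasoning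

sumFin-comm : ∀ {m n} (f : Fin m → Fin n → ℕ) →
              sumFin (λ i → sumFin (f i)) ≡ sumFin (λ j → sumFin (λ i → f i j))
sumFin-comm f = begin
  sumFin (λ i → sumFin (f i))                ≡⟨ sumFin-cong (λ i → sumFin≡sum (f i)) ⟩
  sumFin (λ i → ∑.sum (f i))                 ≡⟨ sumFin≡sum (λ i → ∑.sum (f i)) ⟩
  ∑.sum (λ i → ∑.sum (f i))                  ≡⟨ ∑.∑-comm f ⟩
  ∑.sum (λ j → ∑.sum (λ i → f i j))          ≡⟨ sumFin≡sum (λ j → ∑.sum (λ i → f i j)) ⟨
  sumFin (λ j → ∑.sum (λ i → f i j))         ≡⟨ sumFin-cong (λ j → sumFin≡sum (λ i → f i j)) ⟨
  sumFin (λ j → sumFin (λ i → f i j))        ∎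
  where open ≡-Reasoning

sumFin-involution : ∀ {n} (σ : Fin n → Fin n) → (∀ i → σ (σ i) ≡ i) → (f : Fin n → ℕ) →
                    sumFin (f ∘ σ) ≡ sumFin f
sumFin-involution σ σσ≗id f = begin
  sumFin (f ∘ σ)   ≡⟨ sumFin≡sum (f ∘ σ) ⟩
  ∑.sum (f ∘ σ)    ≡⟨ ∑.sum-permute f (permutation σ σ σσ≗id σσ≗id) ⟨
  ∑.sum f          ≡⟨ sumFin≡sum f ⟨
  sumFin f         ∎
  where open ≡-Reasoning

sumFin-point : ∀ {n} (a : Fin n) (f : Fin n → ℕ) → sumFin (λ i → if a == i then f i else 0) ≡ f a
sumFin-point {suc n} Fin.zero f = trans
  (cong (f Fin.zero +_) (sumFin-zero λ i → cong (λ b → if b then f (Fin.suc i) else 0) (≢⇒==-false {a = Fin.zero} {Fin.suc i} λ ())))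
  (+-identityʳ (f Fin.zero))
sumFin-point {suc n} (Fin.suc a) f = trans
  (cong₂ _+_ (cong (λ b → if b then f Fin.zero else 0) (≢⇒==-false {a = Fin.suc a} {Fin.zero} λ ())) (sumFin-cong suc==suc))
  (sumFin-point a (f ∘ Fin.suc))
  where
  suc==suc : ∀ i → (if Fin.suc a == Fin.suc i then f (Fin.suc i) else 0) ≡ (if a == i then f (Fin.suc i) else 0)
  suc==suc i with a ≟ i
  ... | yes refl = refl
  ... | no _     = refl

count-cong : ∀ {n} {p q : Fin n → Bool} → (∀ i → p i ≡ q i) → count p ≡ count q
count-cong p≗q = sumFin-cong (cong 𝟙 ∘ p≗q)

count-zero : ∀ {n} {p : Fin n → Bool} → (∀ i → p i ≡ false) → count p ≡ 0
count-zero p≗false = sumFin-zero (cong 𝟙 ∘ p≗false)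

count-== : ∀ {n} (a : Fin n) → count (a ==_) ≡ 1
count-== a = sumFin-point a (λ _ → 1)

count-==∧ : ∀ {n} (b : Fin n) (X : Bool) → count (λ w → (b == w) ∧ X) ≡ 𝟙 X
count-==∧ b X = trans (sumFin-cong point) (sumFin-point b (λ _ → 𝟙 X))
  where
  point : ∀ w → 𝟙 ((b == w) ∧ X) ≡ (if b == w then 𝟙 X else 0)
  point w with b == w
  ... | true  = refl
  ... | false = refl

count-remove : ∀ {n} (p : Fin n → Bool) {b} → p b ≡ true → count (λ w → p w ∧ not (b == w)) + 1 ≡ count p
count-remove {n} p {b} pb = begin
  count p∖b + 1                                                    ≡⟨ cong (count p∖b +_) (sumFin-point b (λ _ → 1)) ⟨
  count p∖b + sumFin (λ w → if b == w then 1 else 0)               ≡⟨ sumFin-+ (𝟙 ∘ p∖b) (λ w → if b == w then 1 else 0) ⟨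
  sumFin (λ w → 𝟙 (p∖b w) + (if b == w then 1 else 0))             ≡⟨ sumFin-cong split ⟩
  count p                                                          ∎
  where
  open ≡-Reasoning
  p∖b : Fin n → Bool
  p∖b w = p w ∧ not (b == w)
  split : ∀ w → 𝟙 (p∖b w) + (if b == w then 1 else 0) ≡ 𝟙 (p w)
  split w with b ≟ w
  ... | yes refl rewrite pb = refl
  ... | no _ rewrite ∧-identityʳ (p w) = +-identityʳ _


-- The edges adjacent to an edge

<ᵇ-irrefl : ∀ m → (m <ᵇ m) ≡ false
<ᵇ-irrefl zero    = refl
<ᵇ-irrefl (suc m) = <ᵇ-irrefl m

<ᵇ-asym : ∀ m n → (m <ᵇ n) ≡ true → (n <ᵇ m) ≡ false
<ᵇ-asym zero    (suc n) _   = refl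
<ᵇ-asym (suc m) (suc n) m<n = <ᵇ-asym m n m<n

<ᵇ-connex : ∀ m n → m ≢ n → (m <ᵇ n) ≡ true ⊎ (n <ᵇ m) ≡ true
<ᵇ-connex zero    zero    m≢n = contradiction refl m≢n
<ᵇ-connex zero    (suc n) _   = inj₁ refl
<ᵇ-connex (suc m) zero    _   = inj₂ refl
<ᵇ-connex (suc m) (suc n) m≢n = <ᵇ-connex m n (m≢n ∘ cong suc)

module _ {n : ℕ} where

  _<ᶠ_ : Fin n → Fin n → Bool
  x <ᶠ y = toℕ x <ᵇ toℕ y

  <ᶠ-irrefl : (x : Fin n) → (x <ᶠ x) ≡ false
  <ᶠ-irrefl x = <ᵇ-irrefl (toℕ x)

  <ᶠ-asym : (x y : Fin n) → (x <ᶠ y) ≡ true → (y <ᶠ x) ≡ false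
  <ᶠ-asym x y = <ᵇ-asym (toℕ x) (toℕ y)

  <ᶠ-connex : (x y : Fin n) → x ≢ y → (x <ᶠ y) ≡ true ⊎ (y <ᶠ x) ≡ true
  <ᶠ-connex x y x≢y = <ᵇ-connex (toℕ x) (toℕ y) (x≢y ∘ toℕ-injective)

  count-split-<ᶠ : (u : Fin n) (S : Fin n → Bool) → S u ≡ false →
                   count S ≡ count (λ w → (u <ᶠ w) ∧ S w) + count (λ w → (w <ᶠ u) ∧ S w)
  count-split-<ᶠ u S Su = trans (sumFin-cong split) (sumFin-+ (λ w → 𝟙 ((u <ᶠ w) ∧ S w)) (λ w → 𝟙 ((w <ᶠ u) ∧ S w)))
    where
    exactly-one : ∀ p q s → p ≡ true → q ≡ false → 𝟙 s ≡ 𝟙 (p ∧ s) + 𝟙 (q ∧ s)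
    exactly-one .true .false s refl refl = sym (+-identityʳ _)
    split : ∀ w → 𝟙 (S w) ≡ 𝟙 ((u <ᶠ w) ∧ S w) + 𝟙 ((w <ᶠ u) ∧ S w)
    split w with u ≟ w
    ... | yes refl rewrite <ᶠ-irrefl u | Su = refl
    ... | no u≢w with <ᶠ-connex u w u≢w
    ... | inj₁ u<w = exactly-one (u <ᶠ w) (w <ᶠ u) (S w) u<w (<ᶠ-asym u w u<w)
    ... | inj₂ w<u = trans (exactly-one (w <ᶠ u) (u <ᶠ w) (S w) w<u (<ᶠ-asym w u w<u)) (+-comm (𝟙 ((w <ᶠ u) ∧ S w)) _)

otherNeighbour : ∀ {n} → SimpleGraph n → (Fin n → Fin n → Bool) → Fin n → Fin n → Fin n → Bool
otherNeighbour G Q u b w = Adj G u w ∧ not (b == w) ∧ Q u w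

module _ {n : ℕ} (G : SimpleGraph n) (Q : Fin n → Fin n → Bool) (Q-sym : ∀ x y → Q x y ≡ Q y x) where

  private
    above : Fin n → Fin n → ℕ
    above u b = count (λ w → (u <ᶠ w) ∧ otherNeighbour G Q u b w)

    below : Fin n → Fin n → Fin n → ℕ
    below u b x = 𝟙 ((x <ᶠ u) ∧ otherNeighbour G Q u b x)

    row : Fin n → Fin n → Fin n → ℕ
    row u b x = (if u == x then above u b else 0) + below u b x

    row-self : ∀ u b → row u b u ≡ above u b
    row-self u b rewrite ==-refl u | <ᶠ-irrefl u = +-identityʳ _

    row-end : ∀ u b → u ≢ b → row u b b ≡ 0
    row-end u b u≢b rewrite ≢⇒==-false u≢b | ==-refl b with b <ᶠ u | Adj G u b
    ... | true  | true  = refl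
    ... | true  | false = refl
    ... | false | _     = refl

    row-elsewhere : ∀ {u b x} → u ≢ x → row u b x ≡ below u b x
    row-elsewhere u≢x rewrite ≢⇒==-false u≢x = refl

    sum-row : ∀ u b → sumFin (row u b) ≡ count (otherNeighbour G Q u b)
    sum-row u b = begin
      sumFin (row u b)                            ≡⟨ sumFin-+ (λ x → if u == x then above u b else 0) (below u b) ⟩
      sumFin (λ x → if u == x then above u b else 0) + sumFin (below u b)
                                                  ≡⟨ cong (_+ sumFin (below u b)) (sumFin-point u (λ _ → above u b)) ⟩
      above u b + sumFin (below u b)              ≡⟨ count-split-<ᶠ u (otherNeighbour G Q u b) (cong (_∧ _) (loopless G u)) ⟨
      count (otherNeighbour G Q u b)                  ∎
      where open ≡-Reasoning

  count₂-adjacentEdges : ∀ {a b} → isEdge G a b ≡ true →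
    count₂ (λ x y → adjacentEdges G a b x y ∧ Q x y) ≡ count (otherNeighbour G Q a b) + count (otherNeighbour G Q b a)
  count₂-adjacentEdges {a} {b} ab = begin
    count₂ (λ x y → adjacentEdges G a b x y ∧ Q x y)   ≡⟨ sumFin-cong row-split ⟩
    sumFin (λ x → row a b x + row b a x)              ≡⟨ sumFin-+ (row a b) (row b a) ⟩
    sumFin (row a b) + sumFin (row b a)               ≡⟨ cong₂ _+_ (sum-row a b) (sum-row b a) ⟩
    count (otherNeighbour G Q a b) + count (otherNeighbour G Q b a) ∎
    where
    open ≡-Reasoning
    a<b : (a <ᶠ b) ≡ true
    a<b = ∧-conicalˡ (a <ᶠ b) (Adj G a b) ab

    a≢b : a ≢ b
    a≢b refl with trans (sym a<b) (<ᶠ-irrefl a)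
    ... | ()

    from-a : count (λ y → adjacentEdges G a b a y ∧ Q a y) ≡ above a b
    from-a = count-cong pt
      where
      pt : ∀ y → (adjacentEdges G a b a y ∧ Q a y) ≡ ((a <ᶠ y) ∧ otherNeighbour G Q a b y)
      pt y rewrite ==-refl a with a <ᶠ y | Adj G a y | b == y
      ... | true  | true  | true  = refl
      ... | true  | true  | false = refl
      ... | true  | false | _     = refl
      ... | false | _     | _     = refl

    from-b : count (λ y → adjacentEdges G a b b y ∧ Q b y) ≡ above b a
    from-b = count-cong pt
      where
      pt : ∀ y → (adjacentEdges G a b b y ∧ Q b y) ≡ ((b <ᶠ y) ∧ otherNeighbour G Q b a y)
      pt y with a ≟ y
      ... | yes refl rewrite <ᶠ-asym a b a<b = refl
      ... | no _ rewrite ==-refl b | ≢⇒==-false a≢b with b <ᶠ y | Adj G b y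
      ... | true  | true  = refl
      ... | true  | false = refl
      ... | false | _     = refl

    from-other : ∀ {x} → a ≢ x → b ≢ x →
                 count (λ y → adjacentEdges G a b x y ∧ Q x y) ≡ below a b x + below b a x
    from-other {x} a≢x b≢x = begin
      count (λ y → adjacentEdges G a b x y ∧ Q x y)                 ≡⟨ sumFin-cong pt ⟩
      sumFin (λ y → (if a == y then below a b x else 0) + (if b == y then below b a x else 0))
                                                                    ≡⟨ sumFin-+ (λ y → if a == y then below a b x else 0) _ ⟩
      sumFin (λ y → if a == y then below a b x else 0) + sumFin (λ y → if b == y then below b a x else 0)
                                                                    ≡⟨ cong₂ _+_ (sumFin-point a _) (sumFin-point b _) ⟩
      below a b x + below b a x                                     ∎
      where
      open ≡-Reasoning
      pt : ∀ y → 𝟙 (adjacentEdges G a b x y ∧ Q x y) ≡ (if a == y then below a b x else 0) + (if b == y then below b a x else 0)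
      pt y rewrite ≢⇒==-false a≢x | ≢⇒==-false b≢x with a ≟ y | b ≟ y
      ... | yes refl | yes refl = contradiction refl a≢b
      ... | yes refl | no _ rewrite Adj-sym G x a | Q-sym x a with x <ᶠ a | Adj G a x
      ...   | true  | true  = sym (+-identityʳ _)
      ...   | true  | false = refl
      ...   | false | _     = refl
      pt y | no _ | yes refl rewrite Adj-sym G x b | Q-sym x b with x <ᶠ b | Adj G b x
      ...   | true  | true  = refl
      ...   | true  | false = refl
      ...   | false | _     = refl
      pt y | no _ | no _ with x <ᶠ y | Adj G x y
      ...   | true  | true  = refl
      ...   | true  | false = refl
      ...   | false | _     = refl

    row-split : ∀ x → count (λ y → adjacentEdges G a b x y ∧ Q x y) ≡ row a b x + row b a x
    row-split x = by-cases (a ≟ x) (b ≟ x)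
      where
      by-cases : Dec (a ≡ x) → Dec (b ≡ x) → count (λ y → adjacentEdges G a b x y ∧ Q x y) ≡ row a b x + row b a x
      by-cases (yes refl) _ = trans from-a (sym (trans (cong₂ _+_ (row-self a b) (row-end b a (a≢b ∘ sym))) (+-identityʳ _)))
      by-cases (no _) (yes refl) = trans from-b (sym (cong₂ _+_ (row-end a b a≢b) (row-self b a)))
      by-cases (no a≢x) (no b≢x) = trans (from-other a≢x b≢x) (sym (cong₂ _+_ (row-elsewhere a≢x) (row-elsewhere b≢x)))


-- Transition colourings

module _ {n : ℕ} (G : SimpleGraph n) where

  AtMostTwoNeighbours : Fin n → Set
  AtMostTwoNeighbours u = ∀ {x y z} → Adj G u x ≡ true → Adj G u y ≡ true → Adj G u z ≡ true →
                          x ≡ y ⊎ x ≡ z ⊎ y ≡ z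

  record TransitionColouring (k : ℕ) : Set where
    field
      colour              : Fin n → Fin n → Fin k
      colour-sym          : ∀ u v → colour u v ≡ colour v u
      partner             : Fin n → Fin n → Fin n
      partner-involutive  : ∀ u w → partner u (partner u w) ≡ w
      partner-adjacent    : ∀ {u w} → Adj G u w ≡ true → Adj G u (partner u w) ≡ true
      partner-≢           : ∀ {u w} → Adj G u w ≡ true → partner u w ≢ w
      partners-differ     : ∀ {u v} → Adj G u v ≡ true → colour u (partner u v) ≢ colour v (partner v u)
      partner-colour-≢    : ∀ {u w} → Adj G u w ≡ true →
                            colour u w ≢ colour u (partner u w) ⊎ AtMostTwoNeighbours u

𝟙-∧ʳ : ∀ p q → 𝟙 (p ∧ q) ≤ 𝟙 q
𝟙-∧ʳ true  q = ≤-refl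
𝟙-∧ʳ false q = z≤n

𝟙-==-≢ : ∀ {k} {c₁ c₂ : Fin k} α → c₁ ≢ c₂ → 𝟙 (c₁ == α) + 𝟙 (c₂ == α) ≤ 1
𝟙-==-≢ {c₁ = c₁} {c₂} α c₁≢c₂ with c₁ ≟ α | c₂ ≟ α
... | yes refl | yes refl = contradiction refl c₁≢c₂
... | yes _    | no _     = ≤-refl
... | no _     | yes _    = ≤-refl
... | no _     | no _     = z≤n

𝟙-not-==-≢ : ∀ {k} {c₁ c₂ : Fin k} α → c₁ ≢ c₂ → 1 ≤ 𝟙 (not (c₁ == α)) + 𝟙 (not (c₂ == α))
𝟙-not-==-≢ {c₁ = c₁} {c₂} α c₁≢c₂ with c₁ ≟ α | c₂ ≟ α
... | yes refl | yes refl = contradiction refl c₁≢c₂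
... | yes _    | no _     = ≤-refl
... | no _     | yes _    = ≤-refl
... | no _     | no _     = s≤s z≤n

module _ {n : ℕ} {G : SimpleGraph n} {k : ℕ} (T : TransitionColouring G k) where
  open TransitionColouring T

  colourIs : Fin k → Fin n → Fin n → Bool
  colourIs α x y = colour x y == α

  otherNeighbourColoured : Fin k → Fin n → Fin n → Fin n → Bool
  otherNeighbourColoured α = otherNeighbour G (colourIs α)

  -- partner u pairs up the neighbours of u. Apart from {b , partner u b}, each pair holds at most one edge
  -- of colour α, and partner u b has colour α exactly when the second indicator is 0.
  count-otherNeighbourColoured : ∀ {u b} → Adj G u b ≡ true → ∀ α →
    2 * count (otherNeighbourColoured α u b) + 2 * 𝟙 (not (colour u (partner u b) == α)) ≤ degree G u
  count-otherNeighbourColoured {u} {b} ub α = begin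
    2 * count f + 2 * 𝟙 X                                      ≡⟨ double (count f) (𝟙 X) ⟩
    (count f + count f) + (𝟙 X + 𝟙 X)                          ≡⟨ cong₂ _+_ (cong (_+ count f) (sumFin-involution σ (partner-involutive u) (𝟙 ∘ f)))
                                                                            (cong₂ _+_ (count-==∧ b X) (count-==∧ (σ b) X)) ⟨
    (sumFin (𝟙 ∘ f ∘ σ) + count f) + (count (λ w → (b == w) ∧ X) + count (λ w → (σ b == w) ∧ X))
                                                               ≡⟨ cong₂ _+_ (sumFin-+ (𝟙 ∘ f ∘ σ) (𝟙 ∘ f)) (sumFin-+ (λ w → 𝟙 ((b == w) ∧ X)) _) ⟨
    sumFin (λ w → 𝟙 (f (σ w)) + 𝟙 (f w)) + sumFin (λ w → 𝟙 ((b == w) ∧ X) + 𝟙 ((σ b == w) ∧ X))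
                                                               ≡⟨ sumFin-+ (λ w → 𝟙 (f (σ w)) + 𝟙 (f w)) _ ⟨
    sumFin (λ w → (𝟙 (f (σ w)) + 𝟙 (f w)) + (𝟙 ((b == w) ∧ X) + 𝟙 ((σ b == w) ∧ X)))
                                                               ≤⟨ sumFin-mono-≤ pair-bound ⟩
    degree G u                                                 ∎
    where
    open ≤-Reasoning
    σ : Fin n → Fin n
    σ = partner u
    f : Fin n → Bool
    f = otherNeighbourColoured α u b
    X : Bool
    X = not (colour u (σ b) == α)

    double : ∀ x y → 2 * x + 2 * y ≡ (x + x) + (y + y)
    double = solve-∀

    𝟙f≤ : ∀ w → 𝟙 (f w) ≤ 𝟙 (colourIs α u w)
    𝟙f≤ w = ≤-trans (𝟙-∧ʳ (Adj G u w) _) (𝟙-∧ʳ (not (b == w)) _)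

    pair-≤1 : ∀ {w} → Adj G u w ≡ true → b ≢ w → σ b ≢ w → 𝟙 (f (σ w)) + 𝟙 (f w) ≤ 1
    pair-≤1 {w} uw b≢w σb≢w with partner-colour-≢ uw
    ... | inj₁ different = ≤-trans (+-mono-≤ (𝟙f≤ (σ w)) (𝟙f≤ w)) (𝟙-==-≢ α (different ∘ sym))
    ... | inj₂ two with two uw ub (partner-adjacent ub)
    ...   | inj₁ w≡b         = contradiction (sym w≡b) b≢w
    ...   | inj₂ (inj₁ w≡σb) = contradiction (sym w≡σb) σb≢w
    ...   | inj₂ (inj₂ b≡σb) = contradiction (sym b≡σb) (partner-≢ ub)

    non-neighbour : ∀ {w} → Adj G u w ≡ false → 𝟙 (f (σ w)) + 𝟙 (f w) ≡ 0
    non-neighbour {w} uw rewrite uw with Adj G u (σ w) in uσw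
    ... | false = refl
    ... | true  with trans (sym uw) (subst (λ x → Adj G u x ≡ true) (partner-involutive u w) (partner-adjacent uσw))
    ...   | ()

    at-b : σ b ≢ b → (𝟙 (f (σ b)) + 𝟙 (f b)) + (𝟙 ((b == b) ∧ X) + 𝟙 ((σ b == b) ∧ X)) ≤ 𝟙 (Adj G u b)
    at-b σb≢b rewrite ==-refl b | ub | partner-adjacent ub | ≢⇒==-false (σb≢b ∘ sym) | ≢⇒==-false σb≢b
      with colour u (σ b) == α
    ... | true  = ≤-refl
    ... | false = ≤-refl

    at-σb : b ≢ σ b → (𝟙 (f (σ (σ b))) + 𝟙 (f (σ b))) + (𝟙 ((b == σ b) ∧ X) + 𝟙 ((σ b == σ b) ∧ X)) ≤ 𝟙 (Adj G u (σ b))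
    at-σb b≢σb rewrite partner-involutive u b | ==-refl b | ==-refl (σ b) | ub | partner-adjacent ub | ≢⇒==-false b≢σb
      with colour u (σ b) == α
    ... | true  = ≤-refl
    ... | false = ≤-refl

    off-path : ∀ {w} → b ≢ w → σ b ≢ w → Adj G u w ≡ true ⊎ Adj G u w ≡ false →
               𝟙 (f (σ w)) + 𝟙 (f w) ≤ 𝟙 (Adj G u w)
    off-path b≢w σb≢w (inj₁ uw) = ≤-trans (pair-≤1 uw b≢w σb≢w) (≤-reflexive (cong 𝟙 (sym uw)))
    off-path b≢w σb≢w (inj₂ uw) = ≤-reflexive (trans (non-neighbour uw) (cong 𝟙 (sym uw)))

    pair-bound : ∀ w → (𝟙 (f (σ w)) + 𝟙 (f w)) + (𝟙 ((b == w) ∧ X) + 𝟙 ((σ b == w) ∧ X)) ≤ 𝟙 (Adj G u w)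
    pair-bound w with ≡-or-≢ b w | ≡-or-≢ (σ b) w
    ... | inj₁ refl | inj₁ σb≡b = contradiction σb≡b (partner-≢ ub)
    ... | inj₁ refl | inj₂ σb≢b = at-b σb≢b
    ... | inj₂ b≢w  | inj₁ refl = at-σb b≢w
    ... | inj₂ b≢w  | inj₂ σb≢w = begin
      (𝟙 (f (σ w)) + 𝟙 (f w)) + (𝟙 ((b == w) ∧ X) + 𝟙 ((σ b == w) ∧ X))
                                   ≡⟨ cong (𝟙 (f (σ w)) + 𝟙 (f w) +_) (cong₂ _+_ (𝟙-≢∧ X b≢w) (𝟙-≢∧ X σb≢w)) ⟩
      (𝟙 (f (σ w)) + 𝟙 (f w)) + 0  ≡⟨ +-identityʳ _ ⟩
      𝟙 (f (σ w)) + 𝟙 (f w)        ≤⟨ off-path b≢w σb≢w (true-or-false (Adj G u w)) ⟩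
      𝟙 (Adj G u w)                ∎

  private
    anyColour : Fin n → Fin n → Bool
    anyColour _ _ = true

    count-otherNeighbour : ∀ {u b} → Adj G u b ≡ true → count (otherNeighbour G anyColour u b) + 1 ≡ degree G u
    count-otherNeighbour {u} {b} ub =
      trans (cong (_+ 1) (count-cong λ w → cong (Adj G u w ∧_) (∧-identityʳ (not (b == w))))) (count-remove (Adj G u) ub)

    numAdjacent≡ : ∀ {a b} → isEdge G a b ≡ true →
                   numAdjacent G a b ≡ count (otherNeighbour G anyColour a b) + count (otherNeighbour G anyColour b a)
    numAdjacent≡ {a} {b} ab =
      trans (sumFin-cong λ x → count-cong λ y → sym (∧-identityʳ (adjacentEdges G a b x y)))
            (count₂-adjacentEdges G anyColour (λ _ _ → refl) ab)

  colour-isStrongMajority : IsStrongMajority G colour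
  colour-isStrongMajority a b ab α = +-cancelʳ-≤ 2 _ _ (begin
    2 * numAdjacentColored G colour a b α + 2  ≡⟨ cong (λ x → 2 * x + 2) (count₂-adjacentEdges G (colourIs α) colourIs-sym ab) ⟩
    2 * (Xa + Xb) + 2 * 1                      ≤⟨ +-monoʳ-≤ (2 * (Xa + Xb)) (*-monoʳ-≤ 2 (𝟙-not-==-≢ α (partners-differ a~b))) ⟩
    2 * (Xa + Xb) + 2 * (ιa + ιb)              ≡⟨ regroup Xa Xb ιa ιb ⟩
    (2 * Xa + 2 * ιa) + (2 * Xb + 2 * ιb)      ≤⟨ +-mono-≤ (count-otherNeighbourColoured a~b α) (count-otherNeighbourColoured b~a α) ⟩
    degree G a + degree G b                    ≡⟨ cong₂ _+_ (count-otherNeighbour a~b) (count-otherNeighbour b~a) ⟨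
    (Ya + 1) + (Yb + 1)                        ≡⟨ regroup′ Ya Yb ⟩
    (Ya + Yb) + 2                              ≡⟨ cong (_+ 2) (numAdjacent≡ ab) ⟨
    numAdjacent G a b + 2                      ∎)
    where
    open ≤-Reasoning
    a~b : Adj G a b ≡ true
    a~b = ∧-conicalʳ (a <ᶠ b) (Adj G a b) ab
    b~a : Adj G b a ≡ true
    b~a = trans (Adj-sym G b a) a~b
    colourIs-sym : ∀ x y → colourIs α x y ≡ colourIs α y x
    colourIs-sym x y = cong (_== α) (colour-sym x y)
    Xa Xb Ya Yb ιa ιb : ℕ
    Xa = count (otherNeighbourColoured α a b)
    Xb = count (otherNeighbourColoured α b a)
    Ya = count (otherNeighbour G anyColour a b)
    Yb = count (otherNeighbour G anyColour b a)
    ιa = 𝟙 (not (colour a (partner a b) == α))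
    ιb = 𝟙 (not (colour b (partner b a) == α))
    regroup : ∀ x y i j → 2 * (x + y) + 2 * (i + j) ≡ (2 * x + 2 * i) + (2 * y + 2 * j)
    regroup = solve-∀
    regroup′ : ∀ x y → (x + 1) + (y + 1) ≡ (x + y) + 2
    regroup′ = solve-∀

transitionColouring⇒majIndex≤ : ∀ {n} {G : SimpleGraph n} {k} → TransitionColouring G k → MajIndex≤ G k
transitionColouring⇒majIndex≤ T = colour T , colour-isStrongMajority T
  where open TransitionColouring


-- Undirected edges and edge splits

Edge : ℕ → Set
Edge n = Fin n × Fin n

module _ {n : ℕ} where

  infix 4 _≈ₑ_ _≈ₑ?_ _∈ₑ_

  _≈ₑ_ : Edge n → Edge n → Set
  (a , b) ≈ₑ (c , d) = (a ≡ c × b ≡ d) ⊎ (a ≡ d × b ≡ c)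

  _≈ₑ?_ : Decidable _≈ₑ_
  (a , b) ≈ₑ? (c , d) = ((a ≟ c) ×-dec (b ≟ d)) ⊎-dec ((a ≟ d) ×-dec (b ≟ c))

  ≈ₑ-refl : ∀ {e} → e ≈ₑ e
  ≈ₑ-refl = inj₁ (refl , refl)

  ≈ₑ-sym : ∀ {e f} → e ≈ₑ f → f ≈ₑ e
  ≈ₑ-sym (inj₁ (refl , refl)) = inj₁ (refl , refl)
  ≈ₑ-sym (inj₂ (refl , refl)) = inj₂ (refl , refl)

  ≈ₑ-trans : ∀ {e f g} → e ≈ₑ f → f ≈ₑ g → e ≈ₑ g
  ≈ₑ-trans (inj₁ (refl , refl)) f≈g = f≈g
  ≈ₑ-trans (inj₂ (refl , refl)) (inj₁ (refl , refl)) = inj₂ (refl , refl)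
  ≈ₑ-trans (inj₂ (refl , refl)) (inj₂ (refl , refl)) = inj₁ (refl , refl)

  ≈ₑ-flip : ∀ {a b} → (a , b) ≈ₑ (b , a)
  ≈ₑ-flip = inj₂ (refl , refl)

  ≈ₑ-isEquivalence : IsEquivalence _≈ₑ_
  ≈ₑ-isEquivalence = record { refl = ≈ₑ-refl ; sym = ≈ₑ-sym ; trans = ≈ₑ-trans }

  _∈ₑ_ : Edge n → List (Edge n) → Set
  e ∈ₑ P = Any (e ≈ₑ_) P

  UniqueEdges : List (Edge n) → Set
  UniqueEdges = AllPairs (λ e f → ¬ e ≈ₑ f)

edgeSetoid : ℕ → Setoid 0ℓ 0ℓ
edgeSetoid n = record { isEquivalence = ≈ₑ-isEquivalence {n} }

module _ {n : ℕ} where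

  ∈ₑ-resp-≈ₑ : ∀ {e f} {P : List (Edge n)} → e ≈ₑ f → e ∈ₑ P → f ∈ₑ P
  ∈ₑ-resp-≈ₑ e≈f = Any.map (≈ₑ-trans (≈ₑ-sym e≈f))

  ∈ₑ-resp-↭ : ∀ {e} {P Q : List (Edge n)} → P ↭ Q → e ∈ₑ P → e ∈ₑ Q
  ∈ₑ-resp-↭ = ↭.Any-resp-↭

  UniqueEdges-resp-↭ : {P Q : List (Edge n)} → P ↭ Q → UniqueEdges P → UniqueEdges Q
  UniqueEdges-resp-↭ P↭Q = Perm.Unique-resp-↭ (edgeSetoid n) (↭⇒↭ₛ′ ≈ₑ-isEquivalence P↭Q)

  UniqueEdges-flip : ∀ {P : List (Edge n)} {a b} → UniqueEdges P → (a , b) ∈ P → (b , a) ∈ P → a ≡ b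
  UniqueEdges-flip unique ab∈ ba∈ with ∈-AllPairs₂ unique ab∈ ba∈
  ... | inj₁ ab≡ba        = cong proj₁ ab≡ba
  ... | inj₂ (inj₁ ab≉ba) = contradiction ≈ₑ-flip ab≉ba
  ... | inj₂ (inj₂ ba≉ab) = contradiction ≈ₑ-flip ba≉ab

Adj-resp-≈ₑ : ∀ {n} (G : SimpleGraph n) {a b c d} → (a , b) ≈ₑ (c , d) → Adj G a b ≡ Adj G c d
Adj-resp-≈ₑ G (inj₁ (refl , refl)) = refl
Adj-resp-≈ₑ G (inj₂ (refl , refl)) = Adj-sym G _ _

module _ {n : ℕ} where

  removeEdge : SimpleGraph n → Edge n → SimpleGraph n
  removeEdge H e = record
    { Adj      = λ a b → Adj H a b ∧ not (does (e ≈ₑ? (a , b)))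
    ; sym      = λ a b → cong₂ (λ x y → x ∧ not y) (Adj-sym H a b) (does-⇔ (mk⇔ flip flip) (e ≈ₑ? (a , b)) (e ≈ₑ? (b , a)))
    ; loopless = λ v → cong (_∧ _) (loopless H v)
    }
    where
    flip : ∀ {a b} → e ≈ₑ (a , b) → e ≈ₑ (b , a)
    flip e≈ab = ≈ₑ-trans e≈ab ≈ₑ-flip

  module _ {H : SimpleGraph n} {e : Edge n} where

    removeEdge-⊆ : ∀ {a b} → Adj (removeEdge H e) a b ≡ true → Adj H a b ≡ true
    removeEdge-⊆ {a} {b} = ∧-conicalˡ (Adj H a b) _

    removeEdge-removed : ∀ {a b} → e ≈ₑ (a , b) → Adj (removeEdge H e) a b ≡ false
    removeEdge-removed {a} {b} e≈ab rewrite dec-true (e ≈ₑ? (a , b)) e≈ab = ∧-zeroʳ (Adj H a b)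

    removeEdge-kept : ∀ {a b} → ¬ e ≈ₑ (a , b) → Adj (removeEdge H e) a b ≡ Adj H a b
    removeEdge-kept {a} {b} e≉ab rewrite dec-false (e ≈ₑ? (a , b)) e≉ab = ∧-identityʳ (Adj H a b)

  degreeSum : SimpleGraph n → ℕ
  degreeSum H = sumFin (degree H)

  module _ (H : SimpleGraph n) {t y : Fin n} (ty : Adj H t y ≡ true) where

    private
      t≢y : t ≢ y
      t≢y refl with trans (sym ty) (loopless H t)
      ... | ()

      H⁻ : SimpleGraph n
      H⁻ = removeEdge H (t , y)

      removal-at : ∀ {v u} → (∀ w → (t , y) ≈ₑ (v , w) ⇔ u ≡ w) → Adj H v u ≡ true →
                   degree H⁻ v + 1 ≡ degree H v
      removal-at {v} {u} ≈⇔ vu = trans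
        (cong (_+ 1) (count-cong λ w → cong (λ x → Adj H v w ∧ not x)
          (trans (does-⇔ (≈⇔ w) ((t , y) ≈ₑ? (v , w)) (u ≟ w)) (sym (isYes≗does (u ≟ w))))))
        (count-remove (Adj H v) vu)

    open ≡-Reasoning

    degree-removeEdge : ∀ v → degree H⁻ v + 𝟙 (t == v) + 𝟙 (y == v) ≡ degree H v
    degree-removeEdge v with ≡-or-≢ t v | ≡-or-≢ y v
    ... | inj₁ refl | inj₁ refl = contradiction refl t≢y
    ... | inj₁ refl | inj₂ y≢t = begin
      degree H⁻ t + 𝟙 (t == t) + 𝟙 (y == t)   ≡⟨ cong₂ (λ i j → degree H⁻ t + 𝟙 i + 𝟙 j) (==-refl t) (≢⇒==-false y≢t) ⟩
      degree H⁻ t + 1 + 0                     ≡⟨ +-identityʳ _ ⟩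
      degree H⁻ t + 1                         ≡⟨ removal-at (λ w → mk⇔ at-t λ { refl → ≈ₑ-refl }) ty ⟩
      degree H t                              ∎
      where
      at-t : ∀ {w} → (t , y) ≈ₑ (t , w) → y ≡ w
      at-t (inj₁ (_ , y≡w)) = y≡w
      at-t (inj₂ (_ , y≡t)) = contradiction y≡t y≢t
    ... | inj₂ t≢y | inj₁ refl = begin
      degree H⁻ y + 𝟙 (t == y) + 𝟙 (y == y)   ≡⟨ cong₂ (λ i j → degree H⁻ y + 𝟙 i + 𝟙 j) (≢⇒==-false t≢y) (==-refl y) ⟩
      degree H⁻ y + 0 + 1                     ≡⟨ cong (_+ 1) (+-identityʳ _) ⟩
      degree H⁻ y + 1                         ≡⟨ removal-at (λ w → mk⇔ at-y λ { refl → ≈ₑ-flip }) (trans (Adj-sym H y t) ty) ⟩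
      degree H y                              ∎
      where
      at-y : ∀ {w} → (t , y) ≈ₑ (y , w) → t ≡ w
      at-y (inj₁ (t≡y , _)) = contradiction t≡y t≢y
      at-y (inj₂ (t≡w , _)) = t≡w
    ... | inj₂ t≢v | inj₂ y≢v = begin
      degree H⁻ v + 𝟙 (t == v) + 𝟙 (y == v)   ≡⟨ cong₂ (λ i j → degree H⁻ v + 𝟙 i + 𝟙 j) (≢⇒==-false t≢v) (≢⇒==-false y≢v) ⟩
      degree H⁻ v + 0 + 0                     ≡⟨ trans (+-identityʳ _) (+-identityʳ _) ⟩
      degree H⁻ v                             ≡⟨ count-cong (λ w → removeEdge-kept {H = H} (elsewhere {w})) ⟩
      degree H v                              ∎
      where
      elsewhere : ∀ {w} → ¬ (t , y) ≈ₑ (v , w)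
      elsewhere (inj₁ (t≡v , _)) = t≢v t≡v
      elsewhere (inj₂ (_ , y≡v)) = y≢v y≡v

    degreeSum-removeEdge : degreeSum H⁻ + 2 ≡ degreeSum H
    degreeSum-removeEdge = begin
      degreeSum H⁻ + 2                                            ≡⟨ +-assoc (degreeSum H⁻) 1 1 ⟨
      degreeSum H⁻ + 1 + 1                                        ≡⟨ cong₂ (λ i j → degreeSum H⁻ + i + j) (count-== t) (count-== y) ⟨
      degreeSum H⁻ + count (t ==_) + count (y ==_)                ≡⟨ cong (_+ count (y ==_)) (sumFin-+ (degree H⁻) (𝟙 ∘ (t ==_))) ⟨
      sumFin (λ v → degree H⁻ v + 𝟙 (t == v)) + count (y ==_)     ≡⟨ sumFin-+ (λ v → degree H⁻ v + 𝟙 (t == v)) (𝟙 ∘ (y ==_)) ⟨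
      sumFin (λ v → degree H⁻ v + 𝟙 (t == v) + 𝟙 (y == v))        ≡⟨ sumFin-cong degree-removeEdge ⟩
      degreeSum H                                                 ∎

handshake : ∀ {n} (G : SimpleGraph n) → degreeSum G ≡ 2 * numEdges G
handshake G = begin
  degreeSum G                                             ≡⟨ sumFin-cong (λ a → count-split-<ᶠ a (Adj G a) (loopless G a)) ⟩
  sumFin (λ a → count (isEdge G a) + count (λ b → (b <ᶠ a) ∧ Adj G a b))
                                                          ≡⟨ sumFin-+ (λ a → count (isEdge G a)) _ ⟩
  numEdges G + sumFin (λ a → count (λ b → (b <ᶠ a) ∧ Adj G a b))
                                                          ≡⟨ cong (numEdges G +_) (sumFin-cong λ a → count-cong λ b → cong ((b <ᶠ a) ∧_) (Adj-sym G a b)) ⟩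
  numEdges G + sumFin (λ a → count (λ b → isEdge G b a))  ≡⟨ cong (numEdges G +_) (sumFin-comm (λ a b → 𝟙 (isEdge G b a))) ⟩
  numEdges G + numEdges G                                 ≡⟨ cong (numEdges G +_) (+-identityʳ (numEdges G)) ⟨
  2 * numEdges G                                          ∎
  where open ≡-Reasoning

module _ {n : ℕ} where

  record EdgeSplit (G : SimpleGraph n) (P : List (Edge n)) (H : SimpleGraph n) : Set where
    field
      unique    : UniqueEdges P
      listed    : ∀ {a b} → (a , b) ∈ₑ P → Adj G a b ≡ true × Adj H a b ≡ false
      kept      : ∀ {a b} → Adj H a b ≡ true → Adj G a b ≡ true
      covered   : ∀ {a b} → Adj G a b ≡ true → Adj H a b ≡ true ⊎ (a , b) ∈ₑ P

  open EdgeSplit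

  edgeSplit-[] : (G : SimpleGraph n) → EdgeSplit G [] G
  edgeSplit-[] G = record { unique = [] ; listed = λ () ; kept = λ ab → ab ; covered = inj₁ }

  edgeSplit-↭ : ∀ {G P Q H} → P ↭ Q → EdgeSplit G P H → EdgeSplit G Q H
  edgeSplit-↭ P↭Q S = record
    { unique    = UniqueEdges-resp-↭ P↭Q (unique S)
    ; listed    = listed S ∘ ∈ₑ-resp-↭ (↭-sym P↭Q)
    ; kept      = kept S
    ; covered   = Sum.map₂ (∈ₑ-resp-↭ P↭Q) ∘ covered S
    }

  edgeSplit-removeEdge : ∀ {G P H t y} → EdgeSplit G P H → Adj H t y ≡ true →
                         EdgeSplit G (P ∷ʳ (t , y)) (removeEdge H (t , y))
  edgeSplit-removeEdge {G} {P} {H} {t} {y} S ty = record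
    { unique    = AllPairs.++⁺ (unique S) ([] ∷ []) (All.tabulate λ {e} e∈P → (λ e≈ty → not-in-H e∈P e≈ty) ∷ [])
    ; listed    = listed′
    ; kept      = kept S ∘ removeEdge-⊆ {H = H} {e = t , y}
    ; covered   = covered′
    }
    where
    in-H : ∀ {a b} → (a , b) ≈ₑ (t , y) → Adj H a b ≡ true
    in-H ab≈ty = trans (Adj-resp-≈ₑ H ab≈ty) ty

    not-in-H : ∀ {e} → e ∈ P → ¬ e ≈ₑ (t , y)
    not-in-H {a , b} e∈P ab≈ty with trans (sym (in-H ab≈ty)) (proj₂ (listed S (Any.map (λ { refl → ≈ₑ-refl }) e∈P)))
    ... | ()

    listed′ : ∀ {a b} → (a , b) ∈ₑ (P ∷ʳ (t , y)) → Adj G a b ≡ true × Adj (removeEdge H (t , y)) a b ≡ false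
    listed′ ab∈P′ with AnyP.++⁻ P ab∈P′
    ... | inj₁ ab∈P = proj₁ (listed S ab∈P) , cong (_∧ _) (proj₂ (listed S ab∈P))
    ... | inj₂ (here ab≈ty) = kept S (in-H ab≈ty) , removeEdge-removed {H = H} (≈ₑ-sym ab≈ty)

    covered′ : ∀ {a b} → Adj G a b ≡ true → Adj (removeEdge H (t , y)) a b ≡ true ⊎ (a , b) ∈ₑ (P ∷ʳ (t , y))
    covered′ {a} {b} ab with covered S ab | (t , y) ≈ₑ? (a , b)
    ... | inj₂ ab∈P | _         = inj₂ (AnyP.++⁺ˡ ab∈P)
    ... | inj₁ _    | yes ty≈ab = inj₂ (AnyP.++⁺ʳ P (here (≈ₑ-sym ty≈ab)))
    ... | inj₁ ab∈H | no ty≉ab  = inj₁ (trans (removeEdge-kept {H = H} ty≉ab) ab∈H)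

  edgeSplit-trans : ∀ {G P H Q K} → EdgeSplit G P H → EdgeSplit H Q K → EdgeSplit G (Q ++ P) K
  edgeSplit-trans {G} {P} {H} {Q} {K} S₁ S₂ = record
    { unique    = AllPairs.++⁺ (unique S₂) (unique S₁)
                    (All.tabulate λ e∈Q → All.tabulate λ f∈P e≈f → Q-P-disjoint e∈Q f∈P e≈f)
    ; listed    = listed′
    ; kept      = kept S₁ ∘ kept S₂
    ; covered   = covered′
    }
    where
    as-∈ₑ : ∀ {e} {R : List (Edge n)} → e ∈ R → e ∈ₑ R
    as-∈ₑ = Any.map λ { refl → ≈ₑ-refl }

    Q-P-disjoint : ∀ {e f} → e ∈ Q → f ∈ P → ¬ e ≈ₑ f
    Q-P-disjoint {a , b} {c , d} e∈Q f∈P e≈f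
      with trans (sym (proj₁ (listed S₂ (as-∈ₑ e∈Q)))) (trans (Adj-resp-≈ₑ H e≈f) (proj₂ (listed S₁ (as-∈ₑ f∈P))))
    ... | ()

    not-in-K : ∀ {a b} → Adj H a b ≡ false → Adj K a b ≡ false
    not-in-K {a} {b} ab∉H with true-or-false (Adj K a b)
    ... | inj₂ ab∉K = ab∉K
    ... | inj₁ ab∈K with trans (sym (kept S₂ ab∈K)) ab∉H
    ...   | ()

    listed′ : ∀ {a b} → (a , b) ∈ₑ (Q ++ P) → Adj G a b ≡ true × Adj K a b ≡ false
    listed′ ab∈QP with AnyP.++⁻ Q ab∈QP
    ... | inj₁ ab∈Q = kept S₁ (proj₁ (listed S₂ ab∈Q)) , proj₂ (listed S₂ ab∈Q)
    ... | inj₂ ab∈P = proj₁ (listed S₁ ab∈P) , not-in-K (proj₂ (listed S₁ ab∈P))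

    covered′ : ∀ {a b} → Adj G a b ≡ true → Adj K a b ≡ true ⊎ (a , b) ∈ₑ (Q ++ P)
    covered′ ab with covered S₁ ab
    ... | inj₂ ab∈P = inj₂ (AnyP.++⁺ʳ Q ab∈P)
    ... | inj₁ ab∈H with covered S₂ ab∈H
    ...   | inj₁ ab∈K = inj₁ ab∈K
    ...   | inj₂ ab∈Q = inj₂ (AnyP.++⁺ˡ ab∈Q)

  edgeless : SimpleGraph n
  edgeless = record { Adj = λ _ _ → false ; sym = λ _ _ → refl ; loopless = λ _ → refl }

  edgeSplit-edgeless : ∀ {G P H} → EdgeSplit G P H → (∀ a b → Adj H a b ≡ false) → EdgeSplit G P edgeless
  edgeSplit-edgeless S no-edge = record
    { unique    = unique S
    ; listed    = λ ab∈P → proj₁ (listed S ab∈P) , refl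
    ; kept      = λ ()
    ; covered   = λ {a} {b} ab → Sum.map₁ (λ ab∈H → trans (sym (no-edge a b)) ab∈H) (covered S ab)
    }


-- Walks, circuits and Hierholzer's algorithm

module _ {A : Set} where

  walkEdges : A → List A → List (A × A)
  walkEdges s []       = []
  walkEdges s (x ∷ xs) = (s , x) ∷ walkEdges x xs

  endpoint : A → List A → A
  endpoint s []       = s
  endpoint s (x ∷ xs) = endpoint x xs

  walkEdges-++ : ∀ s xs ys → walkEdges s (xs ++ ys) ≡ walkEdges s xs ++ walkEdges (endpoint s xs) ys
  walkEdges-++ s []       ys = refl
  walkEdges-++ s (x ∷ xs) ys = cong ((s , x) ∷_) (walkEdges-++ x xs ys)

  endpoint-++ : ∀ s xs ys → endpoint s (xs ++ ys) ≡ endpoint (endpoint s xs) ys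
  endpoint-++ s []       ys = refl
  endpoint-++ s (x ∷ xs) ys = endpoint-++ x xs ys

  endpoint-∷ʳ : ∀ s xs x → endpoint s (xs ∷ʳ x) ≡ x
  endpoint-∷ʳ s xs x = endpoint-++ s xs [ x ]

  walkEdges-∷ʳ : ∀ s xs x → walkEdges s (xs ∷ʳ x) ≡ walkEdges s xs ∷ʳ (endpoint s xs , x)
  walkEdges-∷ʳ s xs x = walkEdges-++ s xs [ x ]

  length-walkEdges : ∀ s xs → length (walkEdges s xs) ≡ length xs
  length-walkEdges s []       = refl
  length-walkEdges s (x ∷ xs) = cong suc (length-walkEdges x xs)

  ∈-∷ʳ-head : ∀ {x a : A} {xs} → a ∈ (x ∷ xs) ∷ʳ x → a ∈ x ∷ xs
  ∈-∷ʳ-head (here a≡x) = here a≡x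
  ∈-∷ʳ-head {xs = xs} (there a∈) with ∈-++⁻ xs a∈
  ... | inj₁ a∈xs       = there a∈xs
  ... | inj₂ (here a≡x) = here a≡x

-- (s , ys) is the closed walk s → ys → s
Circuit : ℕ → Set
Circuit n = Fin n × List (Fin n)

module _ {n : ℕ} where

  vertices : Circuit n → List (Fin n)
  vertices (s , ys) = s ∷ ys

  circuitEdges : Circuit n → List (Edge n)
  circuitEdges (s , ys) = walkEdges s (ys ∷ʳ s)

  ∈ₑ-walkEdges⇒∈ : ∀ {s a b : Fin n} {xs} → (a , b) ∈ₑ walkEdges s xs → a ∈ s ∷ xs
  ∈ₑ-walkEdges⇒∈ {xs = x ∷ xs} (here (inj₁ (refl , refl))) = here refl
  ∈ₑ-walkEdges⇒∈ {xs = x ∷ xs} (here (inj₂ (refl , refl))) = there (here refl)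
  ∈ₑ-walkEdges⇒∈ {xs = x ∷ xs} (there ab∈) = there (∈ₑ-walkEdges⇒∈ ab∈)

  ∈⇒∈ₑ-walkEdges : ∀ {s a : Fin n} {xs} → a ∈ xs → ∃ λ b → (a , b) ∈ₑ walkEdges s xs
  ∈⇒∈ₑ-walkEdges {s} (here refl) = s , here ≈ₑ-flip
  ∈⇒∈ₑ-walkEdges (there a∈xs) = map₂ there (∈⇒∈ₑ-walkEdges a∈xs)

  ∈ₑ-circuitEdges⇒∈ : ∀ {s a b : Fin n} {ys} → (a , b) ∈ₑ circuitEdges (s , ys) → a ∈ s ∷ ys
  ∈ₑ-circuitEdges⇒∈ = ∈-∷ʳ-head ∘ ∈ₑ-walkEdges⇒∈

  length-circuitEdges : (C : Circuit n) → length (circuitEdges C) ≡ suc (length (proj₂ C))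
  length-circuitEdges (s , ys) = trans (length-walkEdges s (ys ∷ʳ s)) (trans (length-++ ys) (+-comm (length ys) 1))

  Saturated : SimpleGraph n → Circuit n → Set
  Saturated G C = ∀ {a w} → a ∈ vertices C → Adj G a w ≡ true → (a , w) ∈ₑ circuitEdges C

  ∈⇒∈ₑ-circuitEdges : ∀ {s a : Fin n} {ys} → a ∈ s ∷ ys → ∃ λ b → (a , b) ∈ₑ circuitEdges (s , ys)
  ∈⇒∈ₑ-circuitEdges {s} {ys = ys} (here refl) = ∈⇒∈ₑ-walkEdges (∈-++⁺ʳ ys (here refl))
  ∈⇒∈ₑ-circuitEdges (there a∈ys) = ∈⇒∈ₑ-walkEdges (∈-++⁺ˡ a∈ys)

module _ {A : Set} where

  split-last : ∀ (s : A) xs → xs ≢ [] → ∃ λ ys → xs ≡ ys ∷ʳ endpoint s xs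
  split-last s xs xs≢[] with initLast xs
  ... | []       = contradiction refl xs≢[]
  ... | ys ∷ʳ′ x = ys , cong (ys ∷ʳ_) (sym (endpoint-∷ʳ s ys x))

  endpoint-rotate : ∀ (s : A) P v Q → endpoint s (P ++ v ∷ Q) ≡ endpoint v Q
  endpoint-rotate s P v Q = trans (cong (endpoint s) (sym (++-assoc P [ v ] Q)))
                                  (trans (endpoint-++ s (P ∷ʳ v) Q) (cong (λ e → endpoint e Q) (endpoint-∷ʳ s P v)))

  walkEdges-rotate : ∀ (s : A) P v Q → endpoint s (P ++ v ∷ Q) ≡ s →
                     walkEdges s (P ++ v ∷ Q) ↭ walkEdges v (Q ++ (P ∷ʳ v))
  walkEdges-rotate s P v Q closed = ↭-trans (↭-reflexive split-at-v)
                                            (↭-trans (↭.++-comm (walkEdges s (P ∷ʳ v)) (walkEdges v Q)) (↭-reflexive join-at-s))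
    where
    split-at-v : walkEdges s (P ++ v ∷ Q) ≡ walkEdges s (P ∷ʳ v) ++ walkEdges v Q
    split-at-v = trans (cong (walkEdges s) (sym (++-assoc P [ v ] Q)))
                       (trans (walkEdges-++ s (P ∷ʳ v) Q) (cong (λ e → walkEdges s (P ∷ʳ v) ++ walkEdges e Q) (endpoint-∷ʳ s P v)))
    join-at-s : walkEdges v Q ++ walkEdges s (P ∷ʳ v) ≡ walkEdges v (Q ++ (P ∷ʳ v))
    join-at-s = trans (cong (λ e → walkEdges v Q ++ walkEdges e (P ∷ʳ v)) (trans (sym closed) (endpoint-rotate s P v Q)))
                      (sym (walkEdges-++ v Q (P ∷ʳ v)))

  endpoint-rotated : ∀ (P : List A) v Q → endpoint v (Q ++ (P ∷ʳ v)) ≡ v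
  endpoint-rotated P v Q = trans (endpoint-++ v Q (P ∷ʳ v)) (endpoint-∷ʳ _ P v)

  length-rotate : ∀ (P : List A) v Q → length (Q ++ (P ∷ʳ v)) ≡ length (P ++ v ∷ Q)
  length-rotate P v Q = ↭.↭-length (↭-trans (↭.++-comm Q (P ∷ʳ v)) (↭-reflexive (++-assoc P [ v ] Q)))

  ∷ʳ≢[] : ∀ (xs : List A) x → xs ∷ʳ x ≢ []
  ∷ʳ≢[] []       x ()
  ∷ʳ≢[] (_ ∷ xs) x ()

2∣-cancel-double : ∀ d i → 2 ∣ d + i + i → 2 ∣ d
2∣-cancel-double d i 2∣d+i+i = ∣m+n∣m⇒∣n (subst (2 ∣_) (regroup d i) 2∣d+i+i) (m∣m*n i)
  where
  regroup : ∀ d i → d + i + i ≡ 2 * i + d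
  regroup = solve-∀

2∣-add-double : ∀ d i → 2 ∣ d → 2 ∣ d + i + i
2∣-add-double d i 2∣d = subst (2 ∣_) (regroup d i) (∣m∣n⇒∣m+n (m∣m*n i) 2∣d)
  where
  regroup : ∀ d i → 2 * i + d ≡ d + i + i
  regroup = solve-∀

module _ {n : ℕ} where

  HasEdgeAt : SimpleGraph n → Fin n → Set
  HasEdgeAt H v = ∃ λ w → Adj H v w ≡ true

  hasEdgeAt? : ∀ H v → Dec (HasEdgeAt H v)
  hasEdgeAt? H v = any? (λ w → Adj H v w ≟ᵇ true)

  ¬HasEdgeAt : ∀ {H v} → ¬ HasEdgeAt H v → ∀ w → Adj H v w ≡ false
  ¬HasEdgeAt {H} {v} no-edge w with true-or-false (Adj H v w)
  ... | inj₁ vw = contradiction (w , vw) no-edge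
  ... | inj₂ vw = vw

module _ {n : ℕ} (H₀ : SimpleGraph n) where

  record Trail : Set where
    field
      start     : Fin n
      route     : List (Fin n)
      remaining : SimpleGraph n
      split     : EdgeSplit H₀ (walkEdges start route) remaining
      parity    : ∀ v → 2 ∣ degree remaining v + 𝟙 (start == v) + 𝟙 (endpoint start route == v)
      size      : degreeSum H₀ ≡ degreeSum remaining + 2 * length route

    end : Fin n
    end = endpoint start route

  record SaturatedCircuit : Set where
    field
      circuit   : Circuit n
      remaining : SimpleGraph n
      split     : EdgeSplit H₀ (circuitEdges circuit) remaining
      exhausted : ∀ {a} → a ∈ vertices circuit → ∀ w → Adj remaining a w ≡ false
      even      : AllDegreesEven remaining
      size      : degreeSum H₀ ≡ degreeSum remaining + 2 * length (circuitEdges circuit)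

  circuit-saturated : (C : SaturatedCircuit) → Saturated H₀ (SaturatedCircuit.circuit C)
  circuit-saturated C {a} {w} a∈C aw with EdgeSplit.covered (SaturatedCircuit.split C) aw
  ... | inj₁ aw∈H = contradiction (trans (sym aw∈H) (SaturatedCircuit.exhausted C a∈C w)) true≢false
  ... | inj₂ aw∈C = aw∈C

  trail₀ : AllDegreesEven H₀ → Fin n → Trail
  trail₀ even s = record
    { start     = s
    ; route     = []
    ; remaining = H₀
    ; split     = edgeSplit-[] H₀
    ; parity    = λ v → 2∣-add-double (degree H₀ v) (𝟙 (s == v)) (even v)
    ; size      = sym (+-identityʳ (degreeSum H₀))
    }

  module _ (T : Trail) where
    open Trail T

    extend : ∀ {y} → Adj remaining end y ≡ true → Trail
    extend {y} ty = record
      { start     = start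
      ; route     = route ∷ʳ y
      ; remaining = H⁻
      ; split     = subst (λ P → EdgeSplit H₀ P H⁻) (sym (walkEdges-∷ʳ start route y)) (edgeSplit-removeEdge split ty)
      ; parity    = λ v → subst (λ e → 2 ∣ degree H⁻ v + 𝟙 (start == v) + 𝟙 (e == v))
                                (sym (endpoint-∷ʳ start route y)) (parity′ v)
      ; size      = size′
      }
      where
      open ≡-Reasoning
      H⁻ : SimpleGraph n
      H⁻ = removeEdge remaining (end , y)

      parity′ : ∀ v → 2 ∣ degree H⁻ v + 𝟙 (start == v) + 𝟙 (y == v)
      parity′ v = ∣m+n∣m⇒∣n (subst (2 ∣_) (regroup (degree H⁻ v) (𝟙 (start == v)) (𝟙 (end == v)) (𝟙 (y == v))) old)
                            (m∣m*n (𝟙 (end == v)))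
        where
        regroup : ∀ d s t y → d + t + y + s + t ≡ 2 * t + (d + s + y)
        regroup = solve-∀
        old : 2 ∣ degree H⁻ v + 𝟙 (end == v) + 𝟙 (y == v) + 𝟙 (start == v) + 𝟙 (end == v)
        old = subst (λ d → 2 ∣ d + 𝟙 (start == v) + 𝟙 (end == v)) (sym (degree-removeEdge remaining ty v)) (parity v)

      size′ : degreeSum H₀ ≡ degreeSum H⁻ + 2 * length (route ∷ʳ y)
      size′ = begin
        degreeSum H₀                              ≡⟨ size ⟩
        degreeSum remaining + 2 * length route    ≡⟨ cong (_+ 2 * length route) (degreeSum-removeEdge remaining ty) ⟨
        degreeSum H⁻ + 2 + 2 * length route       ≡⟨ regroup (degreeSum H⁻) (length route) ⟩
        degreeSum H⁻ + 2 * (length route + 1)     ≡⟨ cong (λ l → degreeSum H⁻ + 2 * l) (length-++ route) ⟨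
        degreeSum H⁻ + 2 * length (route ∷ʳ y)    ∎
        where
        regroup : ∀ d l → d + 2 + 2 * l ≡ d + 2 * (l + 1)
        regroup = solve-∀

    extend-decreases : ∀ {y} (ty : Adj remaining end y ≡ true) →
                       degreeSum (Trail.remaining (extend ty)) < degreeSum remaining
    extend-decreases {y} ty =
      subst (degreeSum H⁻ <_) (degreeSum-removeEdge remaining ty) (m<m+n (degreeSum H⁻) (s≤s z≤n))
      where
      H⁻ : SimpleGraph n
      H⁻ = removeEdge remaining (end , y)

    stuck⇒closed : ¬ HasEdgeAt remaining end → end ≡ start
    stuck⇒closed stuck with ≡-or-≢ start end
    ... | inj₁ start≡end = sym start≡end
    ... | inj₂ start≢end with ∣1⇒≡1 (subst (2 ∣_) odd (parity end))
      where
      odd : degree remaining end + 𝟙 (start == end) + 𝟙 (end == end) ≡ 1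
      odd = trans (cong₂ (λ d i → d + 𝟙 i + 𝟙 (end == end)) (count-zero (¬HasEdgeAt {H = remaining} {v = end} stuck)) (≢⇒==-false start≢end))
                  (cong 𝟙 (==-refl end))
    ... | ()

    closed⇒even : end ≡ start → AllDegreesEven remaining
    closed⇒even closed u = 2∣-cancel-double (degree remaining u) (𝟙 (start == u))
                             (subst (λ e → 2 ∣ degree remaining u + 𝟙 (start == u) + 𝟙 (e == u)) closed (parity u))

    rotate : end ≡ start → ∀ P v Q → route ≡ P ++ v ∷ Q → Trail
    rotate closed P v Q route≡ = record
      { start     = v
      ; route     = Q ++ (P ∷ʳ v)
      ; remaining = remaining
      ; split     = edgeSplit-↭ (walkEdges-rotate start P v Q (subst (λ r → endpoint start r ≡ start) route≡ closed))
                                (subst (λ r → EdgeSplit H₀ (walkEdges start r) remaining) route≡ split)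
      ; parity    = λ u → subst (λ e → 2 ∣ degree remaining u + 𝟙 (v == u) + 𝟙 (e == u)) (sym (endpoint-rotated P v Q))
                                (2∣-add-double (degree remaining u) (𝟙 (v == u)) (closed⇒even closed u))
      ; size      = trans size (cong (λ l → degreeSum remaining + 2 * l) (trans (cong length route≡) (sym (length-rotate P v Q))))
      }

    finish : route ≢ [] → end ≡ start → All (¬_ ∘ HasEdgeAt remaining) route → ¬ HasEdgeAt remaining end →
             SaturatedCircuit
    finish route≢[] closed idle stuck = record
      { circuit   = start , stops
      ; remaining = remaining
      ; split     = subst (λ r → EdgeSplit H₀ (walkEdges start r) remaining) route≡ split
      ; exhausted = exhausted
      ; even      = closed⇒even closed
      ; size      = trans size (cong (λ l → degreeSum remaining + 2 * l)
                                     (trans (cong length route≡) (sym (length-walkEdges start (stops ∷ʳ start)))))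
      }
      where
      stops : List (Fin n)
      stops = proj₁ (split-last start route route≢[])
      route≡ : route ≡ stops ∷ʳ start
      route≡ = trans (proj₂ (split-last start route route≢[])) (cong (stops ∷ʳ_) closed)
      exhausted : ∀ {a} → a ∈ start ∷ stops → ∀ w → Adj remaining a w ≡ false
      exhausted (here refl)     = ¬HasEdgeAt {H = remaining} (subst (¬_ ∘ HasEdgeAt remaining) closed stuck)
      exhausted (there a∈stops) = ¬HasEdgeAt {H = remaining} (All.lookup idle (subst (_ ∈_) (sym route≡) (∈-++⁺ˡ a∈stops)))

  -- Extend the trail while its end has an unused edge. Once stuck, the trail is closed (by parity); if one of its
  -- vertices still has an unused edge, rotate the trail to start there and carry on.
  saturate : (T : Trail) → Trail.route T ≢ [] → Acc _<_ (degreeSum (Trail.remaining T)) → SaturatedCircuit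
  saturate T route≢[] (acc smaller) with hasEdgeAt? (Trail.remaining T) (Trail.end T)
  ... | yes (y , ty) = saturate (extend T ty) (∷ʳ≢[] _ y) (smaller (extend-decreases T ty))
  ... | no stuck with Any.any? (hasEdgeAt? (Trail.remaining T)) (Trail.route T)
  ...   | no idle  = finish T route≢[] (stuck⇒closed T stuck) (AllP.¬Any⇒All¬ (Trail.route T) idle) stuck
  ...   | yes busy = continue (find busy)
    where
    continue : (∃ λ v → v ∈ Trail.route T × HasEdgeAt (Trail.remaining T) v) → SaturatedCircuit
    continue (v , v∈route , y , vy) with ∈-∃++ v∈route
    ... | P , Q , route≡ = saturate (extend T′ vy′) (∷ʳ≢[] _ y) (smaller (extend-decreases T′ vy′))
      where
      T′ : Trail
      T′ = rotate T (stuck⇒closed T stuck) P v Q route≡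
      vy′ : Adj (Trail.remaining T′) (Trail.end T′) y ≡ true
      vy′ = subst (λ e → Adj (Trail.remaining T) e y ≡ true) (sym (endpoint-rotated P v Q)) vy

  saturatedCircuit : AllDegreesEven H₀ → ∀ {s y} → Adj H₀ s y ≡ true → SaturatedCircuit
  saturatedCircuit even {s} sy = saturate (extend T₀ sy) (λ ()) (<-wellFounded _)
    where
    T₀ : Trail
    T₀ = trail₀ even s


-- Decomposition into saturated circuits

module _ {n : ℕ} (G : SimpleGraph n) where

  allEdges : List (Circuit n) → List (Edge n)
  allEdges = concatMap circuitEdges

  record CircuitDecomposition : Set where
    field
      circuits  : List (Circuit n)
      split     : EdgeSplit G (allEdges circuits) edgeless
      saturated : All (Saturated G) circuits

  private
    record PartialDecomposition : Set where
      field
        circuits  : List (Circuit n)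
        remaining : SimpleGraph n
        split     : EdgeSplit G (allEdges circuits) remaining
        even      : AllDegreesEven remaining
        saturated : All (Saturated G) circuits

    open EdgeSplit

    add-circuit : (D : PartialDecomposition) → ∀ {v y} → Adj (PartialDecomposition.remaining D) v y ≡ true →
                  Σ PartialDecomposition λ D′ → degreeSum (PartialDecomposition.remaining D′) < degreeSum (PartialDecomposition.remaining D)
    add-circuit D vy = D′ , smaller
      where
      open PartialDecomposition D
      C : SaturatedCircuit remaining
      C = saturatedCircuit remaining even vy
      module C = SaturatedCircuit C

      -- At a vertex shared with an earlier circuit C′, the new circuit has an unused edge, which C′ would
      -- contain by saturation.
      meets-no-old : ∀ {a C′} → C′ ∈ circuits → a ∈ vertices C′ → ¬ a ∈ vertices C.circuit
      meets-no-old {a} C′∈old a∈C′ a∈C = true≢false (trans (sym ab∈H) (proj₂ (listed split ab∈old)))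
        where
        b : Fin n
        b = proj₁ (∈⇒∈ₑ-circuitEdges a∈C)
        ab∈H : Adj remaining a b ≡ true
        ab∈H = proj₁ (listed C.split (proj₂ (∈⇒∈ₑ-circuitEdges a∈C)))
        ab∈old : (a , b) ∈ₑ allEdges circuits
        ab∈old = AnyP.concatMap⁺ circuitEdges (Any.map (λ { refl → All.lookup saturated C′∈old a∈C′ (kept split ab∈H) }) C′∈old)

      C-saturated : Saturated G C.circuit
      C-saturated {a} {w} a∈C aw with covered split aw
      ... | inj₁ aw∈H   = circuit-saturated remaining C a∈C aw∈H
      ... | inj₂ aw∈old with find (AnyP.concatMap⁻ circuitEdges {xs = circuits} aw∈old)
      ...   | C′ , C′∈old , aw∈C′ = contradiction a∈C (meets-no-old C′∈old (∈ₑ-circuitEdges⇒∈ aw∈C′))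

      D′ : PartialDecomposition
      D′ = record
        { circuits  = C.circuit ∷ circuits
        ; remaining = C.remaining
        ; split     = edgeSplit-trans split C.split
        ; even      = C.even
        ; saturated = C-saturated ∷ saturated
        }

      smaller : degreeSum C.remaining < degreeSum remaining
      smaller = subst (degreeSum C.remaining <_) (sym C.size)
                  (m<m+n (degreeSum C.remaining) (subst (λ l → 0 < 2 * l) (sym (length-circuitEdges C.circuit)) (s≤s z≤n)))

    extract : (D : PartialDecomposition) → Acc _<_ (degreeSum (PartialDecomposition.remaining D)) → CircuitDecomposition
    extract D (acc smaller) with any? (hasEdgeAt? (PartialDecomposition.remaining D))
    ... | yes (v , y , vy) = extract (proj₁ (add-circuit D vy)) (smaller (proj₂ (add-circuit D vy)))
    ... | no none = record
      { circuits  = circuits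
      ; split     = edgeSplit-edgeless split (λ a → ¬HasEdgeAt {H = remaining} (λ has → none (a , has)))
      ; saturated = saturated
      }
      where open PartialDecomposition D

  circuitDecomposition : AllDegreesEven G → CircuitDecomposition
  circuitDecomposition even = extract D₀ (<-wellFounded _)
    where
    D₀ : PartialDecomposition
    D₀ = record { circuits = [] ; remaining = G ; split = edgeSplit-[] G ; even = even ; saturated = [] }

  connected⇒eulerian : Connected G → AllDegreesEven G →
    Σ CircuitDecomposition λ D → All (λ C → length (circuitEdges C) ≡ numEdges G) (CircuitDecomposition.circuits D)
  connected⇒eulerian connected even with any? (hasEdgeAt? G)
  ... | no none = record
    { circuits  = []
    ; split     = edgeSplit-edgeless (edgeSplit-[] G) (λ a → ¬HasEdgeAt {H = G} (λ has → none (a , has)))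
    ; saturated = []
    } , []
  ... | yes (_ , _ , sy) = D , length≡ ∷ []
    where
    C : SaturatedCircuit G
    C = saturatedCircuit G even sy
    module C = SaturatedCircuit C

    closed-under-Adj : ∀ {u w} → u ∈ vertices C.circuit → Adj G u w ≡ true → w ∈ vertices C.circuit
    closed-under-Adj u∈C uw = ∈ₑ-circuitEdges⇒∈ (∈ₑ-resp-≈ₑ ≈ₑ-flip (circuit-saturated G C u∈C uw))

    reach : ∀ {u x} → Reachable G u x → u ∈ vertices C.circuit → x ∈ vertices C.circuit
    reach here           u∈C = u∈C
    reach (step uw u⇝x) u∈C = reach u⇝x (closed-under-Adj u∈C uw)

    no-edge-left : ∀ a w → Adj C.remaining a w ≡ false
    no-edge-left a = C.exhausted (reach (connected (proj₁ C.circuit) a) (here refl))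

    D : CircuitDecomposition
    D = record
      { circuits  = C.circuit ∷ []
      ; split     = subst (λ P → EdgeSplit G P edgeless) (sym (++-identityʳ (circuitEdges C.circuit)))
                          (edgeSplit-edgeless C.split no-edge-left)
      ; saturated = circuit-saturated G C ∷ []
      }

    length≡ : length (circuitEdges C.circuit) ≡ numEdges G
    length≡ = *-cancelˡ-≡ _ _ 2 (begin
      2 * length (circuitEdges C.circuit)                        ≡⟨⟩
      0 + 2 * length (circuitEdges C.circuit)                    ≡⟨ cong (_+ 2 * length (circuitEdges C.circuit))
                                                                         (sumFin-zero λ a → count-zero (no-edge-left a)) ⟨
      degreeSum C.remaining + 2 * length (circuitEdges C.circuit) ≡⟨ C.size ⟨
      degreeSum G                                                ≡⟨ handshake G ⟩
      2 * numEdges G                                             ∎)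
      where open ≡-Reasoning

  module _ (D : CircuitDecomposition) where
    open CircuitDecomposition D

    private
      in-allEdges : ∀ {C e} → C ∈ circuits → e ∈ circuitEdges C → e ∈ allEdges circuits
      in-allEdges C∈ e∈ = AnyP.concatMap⁺ circuitEdges (Any.map (λ { refl → e∈ }) C∈)

    listed-edge : ∀ {C a b} → C ∈ circuits → (a , b) ∈ circuitEdges C → Adj G a b ≡ true
    listed-edge C∈ ab∈ = proj₁ (listed split (Any.map (λ { refl → ≈ₑ-refl }) (in-allEdges C∈ ab∈)))

    listed-once : ∀ {C C′ a b} → C ∈ circuits → C′ ∈ circuits → (a , b) ∈ circuitEdges C → ¬ (b , a) ∈ circuitEdges C′
    listed-once {a = a} C∈ C′∈ ab∈ ba∈ =
      true≢false (trans (sym (listed-edge C∈ ab∈))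
                        (trans (cong (Adj G a) (sym (UniqueEdges-flip (unique split) (in-allEdges C∈ ab∈) (in-allEdges C′∈ ba∈))))
                               (loopless G a)))

    circuit-shape : ∀ {s ys} → (s , ys) ∈ circuits → ∃₂ λ y₁ y₂ → ∃ λ ys″ → ys ≡ y₁ ∷ y₂ ∷ ys″
    circuit-shape {s} {[]} C∈ = contradiction (listed-edge C∈ (here refl)) (λ ss → true≢false (trans (sym ss) (loopless G s)))
    circuit-shape {ys = y ∷ []} C∈ = contradiction (there (here refl)) (listed-once C∈ C∈ (here refl))
    circuit-shape {ys = y₁ ∷ y₂ ∷ ys″} C∈ = y₁ , y₂ , ys″ , refl


-- Windows of coloured circuits

module _ {A : Set} where

  quads : A → A → A → List A → List (A × A × A × A)
  quads a b c []      = []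
  quads a b c (d ∷ l) = (a , b , c , d) ∷ quads b c d l

  triples : A → A → List A → List (A × A × A)
  triples a b []      = []
  triples a b (c ∷ l) = (a , b , c) ∷ triples b c l

  cyclicQuads : List A → List (A × A × A × A)
  cyclicQuads (a ∷ b ∷ c ∷ l) = quads a b c (l ++ a ∷ b ∷ c ∷ [])
  cyclicQuads _               = []

  cyclicTriples : List A → List (A × A × A)
  cyclicTriples (a ∷ b ∷ l) = triples a b (l ++ a ∷ b ∷ [])
  cyclicTriples _           = []

  data Slide : A × A × A × A → A × A × A × A → Set where
    slide : ∀ {a b c d e} → Slide (a , b , c , d) (b , c , d , e)

  quads-linked : ∀ a b c l → Linked Slide (quads a b c l)
  quads-linked a b c []          = []
  quads-linked a b c (d ∷ [])    = [-]
  quads-linked a b c (d ∷ e ∷ l) = slide ∷ quads-linked b c d (e ∷ l)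

  quads-∷ʳ : ∀ a b c l p q r z →
             quads a b c (l ++ p ∷ q ∷ r ∷ z ∷ []) ≡ quads a b c (l ++ p ∷ q ∷ r ∷ []) ∷ʳ (p , q , r , z)
  quads-∷ʳ a b c []      p q r z = refl
  quads-∷ʳ a b c (d ∷ l) p q r z = cong ((a , b , c , d) ∷_) (quads-∷ʳ b c d l p q r z)

  -- The first window reappears after the last one, so the cyclic windows are linked all the way round.
  cyclicQuads-linked : ∀ a b c l → ∃₂ λ w ws → cyclicQuads (a ∷ b ∷ c ∷ l) ≡ w ∷ ws × Linked Slide ((w ∷ ws) ∷ʳ w)
  cyclicQuads-linked a b c []      = _ , _ , refl , slide ∷ slide ∷ slide ∷ [-]
  cyclicQuads-linked a b c (d ∷ l) = _ , _ , refl ,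
    subst (Linked Slide) (quads-∷ʳ a b c (d ∷ l) a b c d) (quads-linked a b c (d ∷ l ++ a ∷ b ∷ c ∷ d ∷ []))

  middles-quads : ∀ a b c l z → map (λ (_ , b , c , _) → b , c) (quads a b c (l ∷ʳ z)) ≡ walkEdges b (c ∷ l)
  middles-quads a b c []      z = refl
  middles-quads a b c (d ∷ l) z = cong ((b , c) ∷_) (middles-quads b c d l z)

  firsts-quads : ∀ a b c l z → map (λ (a , b , c , _) → a , b , c) (quads a b c (l ∷ʳ z)) ≡ triples a b (c ∷ l)
  firsts-quads a b c []      z = refl
  firsts-quads a b c (d ∷ l) z = cong ((a , b , c) ∷_) (firsts-quads b c d l z)

module _ {A : Set} {R : A → A → Set} where

  linked-successor : ∀ {ys z y} → Linked R (ys ∷ʳ z) → y ∈ ys → ∃ λ w → w ∈ ys ∷ʳ z × R y w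
  linked-successor {_ ∷ []}    (r ∷ [-]) (here refl) = _ , there (here refl) , r
  linked-successor {_ ∷ _ ∷ _} (r ∷ _)   (here refl) = _ , there (here refl) , r
  linked-successor {_ ∷ _ ∷ _} (_ ∷ l)   (there y∈)  = map₂ (map₁ there) (linked-successor l y∈)

  linked-predecessor : ∀ {x ys y} → Linked R (x ∷ ys) → y ∈ ys → ∃ λ w → w ∈ x ∷ ys × R w y
  linked-predecessor (r ∷ _) (here refl) = _ , here refl , r
  linked-predecessor (_ ∷ l) (there y∈)  = map₂ (map₁ there) (linked-predecessor l y∈)

  cyclic-successor : ∀ {x xs y} → Linked R ((x ∷ xs) ∷ʳ x) → y ∈ x ∷ xs → ∃ λ w → w ∈ x ∷ xs × R y w
  cyclic-successor l y∈ = map₂ (map₁ ∈-∷ʳ-head) (linked-successor l y∈)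

  cyclic-predecessor : ∀ {x xs y} → Linked R ((x ∷ xs) ∷ʳ x) → y ∈ x ∷ xs → ∃ λ w → w ∈ x ∷ xs × R w y
  cyclic-predecessor {x} {xs} l y∈ = map₂ (map₁ ∈-∷ʳ-head) (linked-predecessor l (to-end y∈))
    where
    to-end : ∀ {y} → y ∈ x ∷ xs → y ∈ xs ∷ʳ x
    to-end (here refl) = ∈-++⁺ʳ xs (here refl)
    to-end (there y∈)  = ∈-++⁺ˡ y∈

Dart : ℕ → ℕ → Set
Dart n k = Fin n × Fin k

-- Along a coloured circuit, the dart (v , c) is a vertex v together with the colour c of the circuit
-- edge leaving it. The window (d₀ , d₁ , d₂ , d₃) of four consecutive darts describes the circuit edge
-- from d₁ to d₂ together with the circuit edges before and after it.
Window : ℕ → ℕ → Set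
Window n k = Dart n k × Dart n k × Dart n k × Dart n k

module _ {n k : ℕ} where

  prev src tgt next : Window n k → Fin n
  prev ((x , _) , _)         = x
  src  (_ , (u , _) , _)     = u
  tgt  (_ , _ , (v , _) , _) = v
  next (_ , _ , _ , (y , _)) = y

  prevColour midColour nextColour : Window n k → Fin k
  prevColour ((_ , c) , _)         = c
  midColour  (_ , (_ , c) , _)     = c
  nextColour (_ , _ , (_ , c) , _) = c

  edge : Window n k → Edge n
  edge r = src r , tgt r

module _ {n : ℕ} (G : SimpleGraph n) (k : ℕ) where

  Proper : Window n k → Set
  Proper r = prevColour r ≢ nextColour r × (midColour r ≢ nextColour r ⊎ AtMostTwoNeighbours G (tgt r))

  record WindowSystem : Set where
    field
      windows     : List (Window n k)
      split       : EdgeSplit G (map edge windows) edgeless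
      successor   : ∀ {r} → r ∈ windows → ∃ λ r′ → r′ ∈ windows × Slide r r′
      predecessor : ∀ {r} → r ∈ windows → ∃ λ r′ → r′ ∈ windows × Slide r′ r
      proper      : All Proper windows

module _ {n k : ℕ} where

  slide-prev : ∀ {r r′ : Window n k} → Slide r r′ → prev r′ ≡ src r
  slide-prev slide = refl

  slide-src : ∀ {r r′ : Window n k} → Slide r r′ → src r′ ≡ tgt r
  slide-src slide = refl

  slide-tgt : ∀ {r r′ : Window n k} → Slide r r′ → tgt r′ ≡ next r
  slide-tgt slide = refl

  slide-prevColour : ∀ {r r′ : Window n k} → Slide r r′ → prevColour r′ ≡ midColour r
  slide-prevColour slide = refl

  slide-midColour : ∀ {r r′ : Window n k} → Slide r r′ → midColour r′ ≡ nextColour r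
  slide-midColour slide = refl

  turn : Window n k → Fin n → Fin n
  turn r u = if src r == u then prev r else next r

  turn-src : ∀ r → turn r (src r) ≡ prev r
  turn-src r rewrite ==-refl (src r) = refl

  turn-tgt : ∀ r → src r ≢ tgt r → turn r (tgt r) ≡ next r
  turn-tgt r src≢tgt rewrite ≢⇒==-false src≢tgt = refl

module _ {n k : ℕ} {G : SimpleGraph n} (W : WindowSystem G (suc k)) where
  open WindowSystem W
  open EdgeSplit split using (listed; covered) renaming (unique to unique-edges)

  private
    as-∈ₑ : ∀ {r} → r ∈ windows → edge r ∈ₑ map edge windows
    as-∈ₑ r∈ = AnyP.map⁺ (Any.map (λ { refl → ≈ₑ-refl }) r∈)

    window-edge : ∀ {r} → r ∈ windows → Adj G (src r) (tgt r) ≡ true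
    window-edge r∈ = proj₁ (listed (as-∈ₑ r∈))

    src≢tgt : ∀ {r} → r ∈ windows → src r ≢ tgt r
    src≢tgt {r} r∈ src≡tgt =
      true≢false (trans (sym (window-edge r∈)) (trans (cong (Adj G (src r)) (sym src≡tgt)) (loopless G (src r))))

    same-window : ∀ {r r′} → r ∈ windows → r′ ∈ windows → edge r ≈ₑ edge r′ → r ≡ r′
    same-window r∈ r′∈ r≈r′ with ∈-AllPairs₂ (AllPairs.map⁻ unique-edges) r∈ r′∈
    ... | inj₁ r≡r′         = r≡r′
    ... | inj₂ (inj₁ r≉r′) = contradiction r≈r′ r≉r′
    ... | inj₂ (inj₂ r′≉r) = contradiction (≈ₑ-sym r≈r′) r′≉r

    not-self-successor : ∀ {r} → r ∈ windows → ¬ Slide r r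
    not-self-successor r∈ r⟶r = src≢tgt r∈ (slide-src r⟶r)

    windowAt : ∀ u v → Dec (Any (λ r → (u , v) ≈ₑ edge r) windows)
    windowAt u v = Any.any? (λ r → (u , v) ≈ₑ? edge r) windows

    windowAt-edge : ∀ {u v} → Any (λ r → (u , v) ≈ₑ edge r) windows → Adj G u v ≡ true
    windowAt-edge p = trans (Adj-resp-≈ₑ G (proj₂ (proj₂ (find p)))) (window-edge (proj₁ (proj₂ (find p))))

    found : ∀ {u v r} → r ∈ windows → (u , v) ≈ₑ edge r → (p : Any (λ r → (u , v) ≈ₑ edge r) windows) →
            proj₁ (find p) ≡ r
    found r∈ uv≈r p = same-window (proj₁ (proj₂ (find p))) r∈ (≈ₑ-trans (≈ₑ-sym (proj₂ (proj₂ (find p)))) uv≈r)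

  colourOf : Fin n → Fin n → Fin (suc k)
  colourOf u v with windowAt u v
  ... | yes p = midColour (proj₁ (find p))
  ... | no _  = zero

  partnerOf : Fin n → Fin n → Fin n
  partnerOf u v with windowAt u v
  ... | yes p = turn (proj₁ (find p)) u
  ... | no _  = v

  private
    colourOf-≈ : ∀ {u v r} → r ∈ windows → (u , v) ≈ₑ edge r → colourOf u v ≡ midColour r
    colourOf-≈ {u} {v} r∈ uv≈r with windowAt u v
    ... | yes p  = cong midColour (found r∈ uv≈r p)
    ... | no ¬p = contradiction (Any.map (λ { refl → uv≈r }) r∈) ¬p

    partnerOf-≈ : ∀ {u v r} → r ∈ windows → (u , v) ≈ₑ edge r → partnerOf u v ≡ turn r u
    partnerOf-≈ {u} {v} r∈ uv≈r with windowAt u v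
    ... | yes p  = cong (λ r → turn r u) (found r∈ uv≈r p)
    ... | no ¬p = contradiction (Any.map (λ { refl → uv≈r }) r∈) ¬p

    colourOf-non-edge : ∀ {u v} → Adj G u v ≡ false → colourOf u v ≡ zero
    colourOf-non-edge {u} {v} uv with windowAt u v
    ... | yes p = contradiction (trans (sym (windowAt-edge p)) uv) true≢false
    ... | no _  = refl

    partnerOf-non-edge : ∀ {u v} → Adj G u v ≡ false → partnerOf u v ≡ v
    partnerOf-non-edge {u} {v} uv with windowAt u v
    ... | yes p = contradiction (trans (sym (windowAt-edge p)) uv) true≢false
    ... | no _  = refl

    record AtSrc (r : Window n (suc k)) : Set where
      field
        colour-tgt    : colourOf (src r) (tgt r) ≡ midColour r
        partner-tgt   : partnerOf (src r) (tgt r) ≡ prev r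
        colour-prev   : colourOf (src r) (prev r) ≡ prevColour r
        partner-prev  : partnerOf (src r) (prev r) ≡ tgt r
        adjacent-prev : Adj G (src r) (prev r) ≡ true
        prev≢tgt      : prev r ≢ tgt r
        prev-proper   : midColour r ≢ prevColour r ⊎ AtMostTwoNeighbours G (src r)

    atSrc : ∀ {r} → r ∈ windows → AtSrc r
    atSrc {r} r∈ with predecessor r∈
    ... | p , p∈ , p⟶r = record
      { colour-tgt    = colourOf-≈ r∈ ≈ₑ-refl
      ; partner-tgt   = trans (partnerOf-≈ r∈ ≈ₑ-refl) (turn-src r)
      ; colour-prev   = trans (colourOf-≈ p∈ back) (sym (slide-prevColour p⟶r))
      ; partner-prev  = trans (partnerOf-≈ p∈ back)
                              (trans (cong (turn p) (slide-src p⟶r)) (trans (turn-tgt p (src≢tgt p∈)) (sym (slide-tgt p⟶r))))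
      ; adjacent-prev = trans (Adj-resp-≈ₑ G back) (window-edge p∈)
      ; prev≢tgt      = λ prev≡tgt → not-self-successor r∈ (subst (λ x → Slide x r) (same-window p∈ r∈ (p≈r prev≡tgt)) p⟶r)
      ; prev-proper   = Sum.map (λ p-differs → p-differs ∘ transfer) (subst (AtMostTwoNeighbours G) (sym (slide-src p⟶r)))
                                (proj₂ (All.lookup proper p∈))
      }
      where
      back : (src r , prev r) ≈ₑ edge p
      back = inj₂ (slide-src p⟶r , slide-prev p⟶r)
      p≈r : prev r ≡ tgt r → edge p ≈ₑ edge r
      p≈r prev≡tgt = inj₂ (trans (sym (slide-prev p⟶r)) prev≡tgt , sym (slide-src p⟶r))
      transfer : midColour r ≡ prevColour r → midColour p ≡ nextColour p
      transfer mid≡prev = trans (sym (slide-prevColour p⟶r)) (trans (sym mid≡prev) (slide-midColour p⟶r))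

    record AtTgt (r : Window n (suc k)) : Set where
      field
        colour-src    : colourOf (tgt r) (src r) ≡ midColour r
        partner-src   : partnerOf (tgt r) (src r) ≡ next r
        colour-next   : colourOf (tgt r) (next r) ≡ nextColour r
        partner-next  : partnerOf (tgt r) (next r) ≡ src r
        adjacent-next : Adj G (tgt r) (next r) ≡ true
        next≢src      : next r ≢ src r

    atTgt : ∀ {r} → r ∈ windows → AtTgt r
    atTgt {r} r∈ with successor r∈
    ... | q , q∈ , r⟶q = record
      { colour-src    = colourOf-≈ r∈ ≈ₑ-flip
      ; partner-src   = trans (partnerOf-≈ r∈ ≈ₑ-flip) (turn-tgt r (src≢tgt r∈))
      ; colour-next   = trans (colourOf-≈ q∈ forth) (slide-midColour r⟶q)
      ; partner-next  = trans (partnerOf-≈ q∈ forth) (trans (cong (turn q) (sym (slide-src r⟶q))) (trans (turn-src q) (slide-prev r⟶q)))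
      ; adjacent-next = trans (Adj-resp-≈ₑ G forth) (window-edge q∈)
      ; next≢src      = λ next≡src → not-self-successor r∈ (subst (Slide r) (same-window q∈ r∈ (q≈r next≡src)) r⟶q)
      }
      where
      forth : (tgt r , next r) ≈ₑ edge q
      forth = inj₁ (sym (slide-src r⟶q) , sym (slide-tgt r⟶q))
      q≈r : next r ≡ src r → edge q ≈ₑ edge r
      q≈r next≡src = inj₂ (slide-src r⟶q , trans (slide-tgt r⟶q) next≡src)

    colour-partner-src : ∀ {r} → r ∈ windows → colourOf (src r) (partnerOf (src r) (tgt r)) ≡ prevColour r
    colour-partner-src {r} r∈ = trans (cong (colourOf (src r)) (AtSrc.partner-tgt (atSrc r∈))) (AtSrc.colour-prev (atSrc r∈))

    colour-partner-tgt : ∀ {r} → r ∈ windows → colourOf (tgt r) (partnerOf (tgt r) (src r)) ≡ nextColour r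
    colour-partner-tgt {r} r∈ = trans (cong (colourOf (tgt r)) (AtTgt.partner-src (atTgt r∈))) (AtTgt.colour-next (atTgt r∈))

    data Side (u w : Fin n) : Set where
      at-src : ∀ {r} → r ∈ windows → src r ≡ u → tgt r ≡ w → Side u w
      at-tgt : ∀ {r} → r ∈ windows → tgt r ≡ u → src r ≡ w → Side u w

    side : ∀ {u w} → Adj G u w ≡ true → Side u w
    side uw with covered uw
    ... | inj₂ uw∈ with find (AnyP.map⁻ uw∈)
    ...   | r , r∈ , inj₁ (u≡src , w≡tgt) = at-src r∈ (sym u≡src) (sym w≡tgt)
    ...   | r , r∈ , inj₂ (u≡tgt , w≡src) = at-tgt r∈ (sym u≡tgt) (sym w≡src)

  windowSystem⇒transitionColouring : TransitionColouring G (suc k)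
  windowSystem⇒transitionColouring = record
    { colour             = colourOf
    ; colour-sym         = colour-sym
    ; partner            = partnerOf
    ; partner-involutive = partner-involutive
    ; partner-adjacent   = partner-adjacent
    ; partner-≢          = partner-≢
    ; partners-differ    = partners-differ
    ; partner-colour-≢   = partner-colour-≢
    }
    where
    colour-sym : ∀ u v → colourOf u v ≡ colourOf v u
    colour-sym u v with true-or-false (Adj G u v)
    ... | inj₂ uv = trans (colourOf-non-edge uv) (sym (colourOf-non-edge (trans (Adj-sym G v u) uv)))
    ... | inj₁ uv with side uv
    ...   | at-src r∈ refl refl = trans (AtSrc.colour-tgt (atSrc r∈)) (sym (AtTgt.colour-src (atTgt r∈)))
    ...   | at-tgt r∈ refl refl = trans (AtTgt.colour-src (atTgt r∈)) (sym (AtSrc.colour-tgt (atSrc r∈)))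

    partner-involutive : ∀ u w → partnerOf u (partnerOf u w) ≡ w
    partner-involutive u w with true-or-false (Adj G u w)
    ... | inj₂ uw = trans (cong (partnerOf u) (partnerOf-non-edge uw)) (partnerOf-non-edge uw)
    ... | inj₁ uw with side uw
    ...   | at-src r∈ refl refl = trans (cong (partnerOf _) (AtSrc.partner-tgt (atSrc r∈))) (AtSrc.partner-prev (atSrc r∈))
    ...   | at-tgt r∈ refl refl = trans (cong (partnerOf _) (AtTgt.partner-src (atTgt r∈))) (AtTgt.partner-next (atTgt r∈))

    partner-adjacent : ∀ {u w} → Adj G u w ≡ true → Adj G u (partnerOf u w) ≡ true
    partner-adjacent uw with side uw
    ... | at-src r∈ refl refl = subst (λ x → Adj G _ x ≡ true) (sym (AtSrc.partner-tgt (atSrc r∈))) (AtSrc.adjacent-prev (atSrc r∈))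
    ... | at-tgt r∈ refl refl = subst (λ x → Adj G _ x ≡ true) (sym (AtTgt.partner-src (atTgt r∈))) (AtTgt.adjacent-next (atTgt r∈))

    partner-≢ : ∀ {u w} → Adj G u w ≡ true → partnerOf u w ≢ w
    partner-≢ uw with side uw
    ... | at-src r∈ refl refl = AtSrc.prev≢tgt (atSrc r∈) ∘ trans (sym (AtSrc.partner-tgt (atSrc r∈)))
    ... | at-tgt r∈ refl refl = AtTgt.next≢src (atTgt r∈) ∘ trans (sym (AtTgt.partner-src (atTgt r∈)))

    partners-differ : ∀ {u v} → Adj G u v ≡ true → colourOf u (partnerOf u v) ≢ colourOf v (partnerOf v u)
    partners-differ uv with side uv
    ... | at-src r∈ refl refl = λ same → proj₁ (All.lookup proper r∈)
                                          (trans (sym (colour-partner-src r∈)) (trans same (colour-partner-tgt r∈)))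
    ... | at-tgt r∈ refl refl = λ same → proj₁ (All.lookup proper r∈)
                                          (trans (sym (colour-partner-src r∈)) (trans (sym same) (colour-partner-tgt r∈)))

    partner-colour-≢ : ∀ {u w} → Adj G u w ≡ true → colourOf u w ≢ colourOf u (partnerOf u w) ⊎ AtMostTwoNeighbours G u
    partner-colour-≢ uw with side uw
    ... | at-src r∈ refl refl = Sum.map₁
      (λ differ same → differ (trans (sym (AtSrc.colour-tgt (atSrc r∈))) (trans same (colour-partner-src r∈))))
      (AtSrc.prev-proper (atSrc r∈))
    ... | at-tgt r∈ refl refl = Sum.map₁
      (λ differ same → differ (trans (sym (AtTgt.colour-src (atTgt r∈))) (trans same (colour-partner-tgt r∈))))
      (proj₂ (All.lookup proper r∈))

module _ {A B : Set} where

  map-proj₁-zip : ∀ (xs : List A) (ys : List B) → length xs ≡ length ys → map proj₁ (zip xs ys) ≡ xs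
  map-proj₁-zip []       []       _   = refl
  map-proj₁-zip (x ∷ xs) (y ∷ ys) len = cong (x ∷_) (map-proj₁-zip xs ys (suc-injective len))

  map-proj₂-zip : ∀ (xs : List A) (ys : List B) → length xs ≡ length ys → map proj₂ (zip xs ys) ≡ ys
  map-proj₂-zip []       []       _   = refl
  map-proj₂-zip (x ∷ xs) (y ∷ ys) len = cong (y ∷_) (map-proj₂-zip xs ys (suc-injective len))

  walkEdges-map : ∀ (f : A → B) s xs → map (map× f f) (walkEdges s xs) ≡ walkEdges (f s) (map f xs)
  walkEdges-map f s []       = refl
  walkEdges-map f s (x ∷ xs) = cong (_ ∷_) (walkEdges-map f x xs)

  triples-map : ∀ (f : A → B) a b l → map (λ (a , b , c) → f a , f b , f c) (triples a b l) ≡ triples (f a) (f b) (map f l)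
  triples-map f a b []      = refl
  triples-map f a b (c ∷ l) = cong (_ ∷_) (triples-map f b c l)

ProperTriple : ∀ {k} → Fin k × Fin k × Fin k → Set
ProperTriple (x , y , z) = x ≢ z × y ≢ z

module _ {n k : ℕ} where

  circuitWindows : Circuit n → List (Fin k) → List (Window n k)
  circuitWindows (s , ys) S = cyclicQuads (zip (s ∷ ys) S)

  colourTriple : Window n k → Fin k × Fin k × Fin k
  colourTriple r = prevColour r , midColour r , nextColour r

  module _ (s y₁ y₂ : Fin n) (ys : List (Fin n)) (c₀ c₁ c₂ : Fin k) (S : List (Fin k)) (len : length ys ≡ length S) where

    private
      e₀ e₁ e₂ : Dart n k
      e₀ = s , c₀
      e₁ = y₁ , c₁
      e₂ = y₂ , c₂
      Z : List (Dart n k)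
      Z = zip ys S

      windows≡ : circuitWindows (s , y₁ ∷ y₂ ∷ ys) (c₀ ∷ c₁ ∷ c₂ ∷ S) ≡ quads e₀ e₁ e₂ ((Z ++ e₀ ∷ e₁ ∷ []) ∷ʳ e₂)
      windows≡ = cong (quads e₀ e₁ e₂) (sym (++-assoc Z (e₀ ∷ e₁ ∷ []) [ e₂ ]))

    circuitWindows-edges : map edge (circuitWindows (s , y₁ ∷ y₂ ∷ ys) (c₀ ∷ c₁ ∷ c₂ ∷ S)) ↭ circuitEdges (s , y₁ ∷ y₂ ∷ ys)
    circuitWindows-edges = ↭-trans (↭-reflexive edges≡) (↭-sym (↭.∷↭∷ʳ (s , y₁) (walkEdges y₁ (y₂ ∷ ys ∷ʳ s))))
      where
      open ≡-Reasoning
      edges≡ : map edge (circuitWindows (s , y₁ ∷ y₂ ∷ ys) (c₀ ∷ c₁ ∷ c₂ ∷ S)) ≡ walkEdges y₁ (y₂ ∷ ys ∷ʳ s) ∷ʳ (s , y₁)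
      edges≡ = begin
        map edge (circuitWindows (s , y₁ ∷ y₂ ∷ ys) (c₀ ∷ c₁ ∷ c₂ ∷ S))
          ≡⟨ cong (map edge) windows≡ ⟩
        map edge (quads e₀ e₁ e₂ ((Z ++ e₀ ∷ e₁ ∷ []) ∷ʳ e₂))
          ≡⟨ map-∘ (quads e₀ e₁ e₂ ((Z ++ e₀ ∷ e₁ ∷ []) ∷ʳ e₂)) ⟩
        map (map× proj₁ proj₁) (map (λ (_ , b , c , _) → b , c) (quads e₀ e₁ e₂ ((Z ++ e₀ ∷ e₁ ∷ []) ∷ʳ e₂)))
          ≡⟨ cong (map (map× proj₁ proj₁)) (middles-quads e₀ e₁ e₂ (Z ++ e₀ ∷ e₁ ∷ []) e₂) ⟩
        map (map× proj₁ proj₁) (walkEdges e₁ (e₂ ∷ Z ++ e₀ ∷ e₁ ∷ []))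
          ≡⟨ walkEdges-map proj₁ e₁ (e₂ ∷ Z ++ e₀ ∷ e₁ ∷ []) ⟩
        walkEdges y₁ (y₂ ∷ map proj₁ (Z ++ e₀ ∷ e₁ ∷ []))
          ≡⟨ cong (λ l → walkEdges y₁ (y₂ ∷ l)) (trans (map-++ proj₁ Z (e₀ ∷ e₁ ∷ [])) (cong (_++ s ∷ y₁ ∷ []) (map-proj₁-zip ys S len))) ⟩
        walkEdges y₁ (y₂ ∷ ys ++ s ∷ y₁ ∷ [])
          ≡⟨ cong (λ l → walkEdges y₁ (y₂ ∷ l)) (sym (++-assoc ys [ s ] [ y₁ ])) ⟩
        walkEdges y₁ ((y₂ ∷ ys ∷ʳ s) ∷ʳ y₁)
          ≡⟨ walkEdges-∷ʳ y₁ (y₂ ∷ ys ∷ʳ s) y₁ ⟩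
        walkEdges y₁ (y₂ ∷ ys ∷ʳ s) ∷ʳ (endpoint y₁ (y₂ ∷ ys ∷ʳ s) , y₁)
          ≡⟨ cong (λ v → walkEdges y₁ (y₂ ∷ ys ∷ʳ s) ∷ʳ (v , y₁)) (endpoint-∷ʳ y₁ (y₂ ∷ ys) s) ⟩
        walkEdges y₁ (y₂ ∷ ys ∷ʳ s) ∷ʳ (s , y₁)
          ∎

    circuitWindows-colours : map colourTriple (circuitWindows (s , y₁ ∷ y₂ ∷ ys) (c₀ ∷ c₁ ∷ c₂ ∷ S)) ≡ cyclicTriples (c₀ ∷ c₁ ∷ c₂ ∷ S)
    circuitWindows-colours = begin
      map colourTriple (circuitWindows (s , y₁ ∷ y₂ ∷ ys) (c₀ ∷ c₁ ∷ c₂ ∷ S))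
        ≡⟨ cong (map colourTriple) windows≡ ⟩
      map colourTriple (quads e₀ e₁ e₂ ((Z ++ e₀ ∷ e₁ ∷ []) ∷ʳ e₂))
        ≡⟨ map-∘ (quads e₀ e₁ e₂ ((Z ++ e₀ ∷ e₁ ∷ []) ∷ʳ e₂)) ⟩
      map (λ (a , b , c) → proj₂ a , proj₂ b , proj₂ c) (map (λ (a , b , c , _) → a , b , c) (quads e₀ e₁ e₂ ((Z ++ e₀ ∷ e₁ ∷ []) ∷ʳ e₂)))
        ≡⟨ cong (map _) (firsts-quads e₀ e₁ e₂ (Z ++ e₀ ∷ e₁ ∷ []) e₂) ⟩
      map (λ (a , b , c) → proj₂ a , proj₂ b , proj₂ c) (triples e₀ e₁ (e₂ ∷ Z ++ e₀ ∷ e₁ ∷ []))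
        ≡⟨ triples-map proj₂ e₀ e₁ (e₂ ∷ Z ++ e₀ ∷ e₁ ∷ []) ⟩
      triples c₀ c₁ (c₂ ∷ map proj₂ (Z ++ e₀ ∷ e₁ ∷ []))
        ≡⟨ cong (λ l → triples c₀ c₁ (c₂ ∷ l)) (trans (map-++ proj₂ Z (e₀ ∷ e₁ ∷ [])) (cong (_++ c₀ ∷ c₁ ∷ []) (map-proj₂-zip ys S len))) ⟩
      cyclicTriples (c₀ ∷ c₁ ∷ c₂ ∷ S)
        ∎
      where open ≡-Reasoning

    circuitWindows-linked : ∃₂ λ w ws → circuitWindows (s , y₁ ∷ y₂ ∷ ys) (c₀ ∷ c₁ ∷ c₂ ∷ S) ≡ w ∷ ws × Linked Slide ((w ∷ ws) ∷ʳ w)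
    circuitWindows-linked = cyclicQuads-linked e₀ e₁ e₂ Z

concatMap-↭ : ∀ {A B : Set} {f g : A → List B} {xs} → All (λ x → f x ↭ g x) xs → concatMap f xs ↭ concatMap g xs
concatMap-↭ []         = ↭-reflexive refl
concatMap-↭ (p ∷ ps) = ↭.++⁺ p (concatMap-↭ ps)

module _ {n k : ℕ} {G : SimpleGraph n} (D : CircuitDecomposition G) where
  open CircuitDecomposition D

  ProperlyColoured : (Circuit n → List (Fin k)) → Circuit n → Set
  ProperlyColoured colours C = length (colours C) ≡ length (vertices C) × All (Proper G k) (circuitWindows C (colours C))

  private
    record Traverses (C : Circuit n) (S : List (Fin k)) : Set where
      field
        edges   : map edge (circuitWindows C S) ↭ circuitEdges C
        linked  : ∃₂ λ w ws → circuitWindows C S ≡ w ∷ ws × Linked Slide ((w ∷ ws) ∷ʳ w)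
        colours : map colourTriple (circuitWindows C S) ≡ cyclicTriples S

    traverses : ∀ {s ys} → (s , ys) ∈ circuits → ∀ S → length S ≡ suc (length ys) → Traverses (s , ys) S
    traverses {s} C∈ S len with circuit-shape G D C∈
    ... | y₁ , y₂ , ys , refl = go S len
      where
      go : ∀ S → length S ≡ suc (length (y₁ ∷ y₂ ∷ ys)) → Traverses (s , y₁ ∷ y₂ ∷ ys) S
      go (c₀ ∷ c₁ ∷ c₂ ∷ S) len′ = record
        { edges   = circuitWindows-edges s y₁ y₂ ys c₀ c₁ c₂ S len″
        ; linked  = circuitWindows-linked s y₁ y₂ ys c₀ c₁ c₂ S len″
        ; colours = circuitWindows-colours s y₁ y₂ ys c₀ c₁ c₂ S len″
        }
        where
        len″ : length ys ≡ length S
        len″ = sym (suc-injective (suc-injective (suc-injective len′)))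

  circuitWindows-proper : ∀ {s ys} → (s , ys) ∈ circuits → ∀ S → length S ≡ suc (length ys) →
                          All ProperTriple (cyclicTriples S) → All (Proper G k) (circuitWindows (s , ys) S)
  circuitWindows-proper C∈ S len proper =
    All.map (λ (x≢z , y≢z) → x≢z , inj₁ y≢z)
      (AllP.map⁻ (subst (All ProperTriple) (sym (Traverses.colours (traverses C∈ S len))) proper))

  decomposition⇒windowSystem : (colours : Circuit n → List (Fin k)) → All (ProperlyColoured colours) circuits → WindowSystem G k
  decomposition⇒windowSystem colours coloured = record
    { windows     = windows
    ; split       = edgeSplit-↭ (↭-sym edges↭) split
    ; successor   = successor
    ; predecessor = predecessor
    ; proper      = AllP.concat⁺ (AllP.map⁺ (All.map proj₂ coloured))
    }
    where
    windowsOf : Circuit n → List (Window n k)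
    windowsOf C = circuitWindows C (colours C)
    windows : List (Window n k)
    windows = concatMap windowsOf circuits

    per-circuit : ∀ {C} → C ∈ circuits → Traverses C (colours C)
    per-circuit {s , ys} C∈ = traverses C∈ (colours (s , ys)) (proj₁ (All.lookup coloured C∈))

    edges↭ : map edge windows ↭ allEdges G circuits
    edges↭ = ↭-trans (↭-reflexive (map-concatMap edge windowsOf circuits))
                     (concatMap-↭ (All.tabulate (Traverses.edges ∘ per-circuit)))

    lift : ∀ {C r} → C ∈ circuits → r ∈ windowsOf C → r ∈ windows
    lift C∈ r∈ = AnyP.concatMap⁺ windowsOf (Any.map (λ { refl → r∈ }) C∈)

    successor : ∀ {r} → r ∈ windows → ∃ λ r′ → r′ ∈ windows × Slide r r′
    successor r∈ with find (AnyP.concatMap⁻ windowsOf {xs = circuits} r∈)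
    ... | C , C∈ , r∈C with Traverses.linked (per-circuit C∈)
    ...   | w , ws , ≡w∷ws , linked with cyclic-successor linked (subst (_ ∈_) ≡w∷ws r∈C)
    ...     | r′ , r′∈ , r⟶r′ = r′ , lift C∈ (subst (_ ∈_) (sym ≡w∷ws) r′∈) , r⟶r′

    predecessor : ∀ {r} → r ∈ windows → ∃ λ r′ → r′ ∈ windows × Slide r′ r
    predecessor r∈ with find (AnyP.concatMap⁻ windowsOf {xs = circuits} r∈)
    ... | C , C∈ , r∈C with Traverses.linked (per-circuit C∈)
    ...   | w , ws , ≡w∷ws , linked with cyclic-predecessor linked (subst (_ ∈_) ≡w∷ws r∈C)
    ...     | r′ , r′∈ , r′⟶r = r′ , lift C∈ (subst (_ ∈_) (sym ≡w∷ws) r′∈) , r′⟶r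


-- Colour patterns

data Block (k : ℕ) : Set where
  short : Block k
  long  : Fin k → Block k

module _ {k : ℕ} where

  blockTail : Block k → List (Fin (3 + k))
  blockTail short    = 2F ∷ []
  blockTail (long c) = 2F ∷ suc (suc (suc c)) ∷ []

  blockColours : Block k → List (Fin (3 + k))
  blockColours b = 0F ∷ 1F ∷ blockTail b

  colourPattern : List (Block k) → List (Fin (3 + k))
  colourPattern = concatMap blockColours

  private
    cycled : List (Block k) → List (Fin (3 + k))
    cycled = concatMap (λ b → blockTail b ++ 0F ∷ 1F ∷ [])

    pattern-++-01 : ∀ bs → colourPattern bs ++ 0F ∷ 1F ∷ [] ≡ 0F ∷ 1F ∷ cycled bs
    tail-++-01 : ∀ b bs → (blockTail b ++ colourPattern bs) ++ 0F ∷ 1F ∷ [] ≡ cycled (b ∷ bs)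

    pattern-++-01 []       = refl
    pattern-++-01 (b ∷ bs) = cong (λ l → 0F ∷ 1F ∷ l) (tail-++-01 b bs)

    tail-++-01 b bs = trans (++-assoc (blockTail b) (colourPattern bs) (0F ∷ 1F ∷ []))
                      (trans (cong (blockTail b ++_) (pattern-++-01 bs)) (sym (++-assoc (blockTail b) (0F ∷ 1F ∷ []) (cycled bs))))

    cyclicTriples-pattern : ∀ bs → cyclicTriples (colourPattern bs) ≡ triples 0F 1F (cycled bs)
    cyclicTriples-pattern []       = refl
    cyclicTriples-pattern (b ∷ bs) = cong (triples 0F 1F) (tail-++-01 b bs)

    proper-cycled : ∀ bs → All ProperTriple (triples 0F 1F (cycled bs))
    proper-cycled []            = []
    proper-cycled (short ∷ bs)  = ((λ ()) , (λ ())) ∷ ((λ ()) , (λ ())) ∷ ((λ ()) , (λ ())) ∷ proper-cycled bs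
    proper-cycled (long c ∷ bs) = ((λ ()) , (λ ())) ∷ ((λ ()) , (λ ())) ∷ ((λ ()) , (λ ())) ∷ ((λ ()) , (λ ())) ∷ proper-cycled bs

  colourPattern-proper : ∀ bs → All ProperTriple (cyclicTriples (colourPattern bs))
  colourPattern-proper bs = subst (All ProperTriple) (sym (cyclicTriples-pattern bs)) (proper-cycled bs)

length-colourPattern-short : ∀ q → length (colourPattern {0} (replicate q short)) ≡ q * 3
length-colourPattern-short zero    = refl
length-colourPattern-short (suc q) = cong (3 +_) (length-colourPattern-short q)

-- 3 + m as a sum of 3s and 4s, for m ≢ 2
blocks₄ : ℕ → List (Block 1)
blocks₄ 3                   = short ∷ []
blocks₄ 4                   = long 0F ∷ []
blocks₄ 8                   = long 0F ∷ long 0F ∷ []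
blocks₄ (suc (suc (suc m))) = short ∷ blocks₄ m
blocks₄ _                   = []

length-blocks₄ : ∀ m → m ≢ 2 → length (colourPattern (blocks₄ (3 + m))) ≡ 3 + m
length-blocks₄ 0 _   = refl
length-blocks₄ 1 _   = refl
length-blocks₄ 2 m≢2 = contradiction refl m≢2
length-blocks₄ 3 _   = refl
length-blocks₄ 4 _   = refl
length-blocks₄ 5 _   = refl
length-blocks₄ (suc (suc (suc (suc (suc (suc m)))))) _ = cong (3 +_) (length-blocks₄ (suc (suc (suc m))) λ ())


two-values : ∀ {A : Set} {a b x y z : A} → x ≡ a ⊎ x ≡ b → y ≡ a ⊎ y ≡ b → z ≡ a ⊎ z ≡ b → x ≡ y ⊎ x ≡ z ⊎ y ≡ z
two-values (inj₁ refl) (inj₁ refl) _           = inj₁ refl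
two-values (inj₂ refl) (inj₂ refl) _           = inj₁ refl
two-values (inj₁ refl) (inj₂ refl) (inj₁ refl) = inj₂ (inj₁ refl)
two-values (inj₁ refl) (inj₂ refl) (inj₂ refl) = inj₂ (inj₂ refl)
two-values (inj₂ refl) (inj₁ refl) (inj₁ refl) = inj₂ (inj₂ refl)
two-values (inj₂ refl) (inj₁ refl) (inj₂ refl) = inj₂ (inj₁ refl)

-- No four-colouring of a 5-cycle gives three distinct colours to every three consecutive edges; here the
-- two edges of colour 1 meet at a vertex of degree 2.
colours₄ : ∀ {n} → Circuit n → List (Fin 4)
colours₄ (_ , _ ∷ _ ∷ _ ∷ _ ∷ []) = 0F ∷ 1F ∷ 1F ∷ 2F ∷ 3F ∷ []
colours₄ (_ , ys)                 = colourPattern (blocks₄ (suc (length ys)))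

colours₃ : ∀ {n} → Circuit n → List (Fin 3)
colours₃ C = colourPattern (replicate (length (vertices C) / 3) short)

module _ {n : ℕ} {G : SimpleGraph n} (D : CircuitDecomposition G) where
  open CircuitDecomposition D

  -- By saturation each neighbour of y₂ is joined to it by a circuit edge; as no circuit edge is a loop or is
  -- listed twice, these neighbours are y₁ and y₃.
  pentagon⇒atMostTwoNeighbours : ∀ {s y₁ y₂ y₃ y₄} → (s , y₁ ∷ y₂ ∷ y₃ ∷ y₄ ∷ []) ∈ circuits → AtMostTwoNeighbours G y₂
  pentagon⇒atMostTwoNeighbours {s} {y₁} {y₂} {y₃} {y₄} C∈ y₂x y₂y y₂z = two-values (neighbour y₂x) (neighbour y₂y) (neighbour y₂z)
    where
    C : Circuit n
    C = s , y₁ ∷ y₂ ∷ y₃ ∷ y₄ ∷ []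
    distinct : ∀ {a b} → (a , b) ∈ circuitEdges C → a ≢ b
    distinct {a} ab∈ refl = true≢false (trans (sym (listed-edge G D C∈ ab∈)) (loopless G a))
    neighbour : ∀ {w} → Adj G y₂ w ≡ true → w ≡ y₁ ⊎ w ≡ y₃
    neighbour y₂w with All.lookup saturated C∈ (there (there (here refl))) y₂w
    ... | here (inj₁ (_ , w≡y₁))                            = inj₁ w≡y₁
    ... | here (inj₂ (y₂≡y₁ , _))                           = contradiction (sym y₂≡y₁) (distinct (there (here refl)))
    ... | there (here (inj₁ (y₂≡y₁ , _)))                   = contradiction (sym y₂≡y₁) (distinct (there (here refl)))
    ... | there (here (inj₂ (_ , w≡y₁)))                    = inj₁ w≡y₁
    ... | there (there (here (inj₁ (_ , w≡y₃))))            = inj₂ w≡y₃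
    ... | there (there (here (inj₂ (y₂≡y₃ , _))))           = contradiction y₂≡y₃ (distinct (there (there (here refl))))
    ... | there (there (there (here (inj₁ (y₂≡y₃ , _)))))   = contradiction y₂≡y₃ (distinct (there (there (here refl))))
    ... | there (there (there (here (inj₂ (_ , w≡y₃)))))    = inj₂ w≡y₃
    ... | there (there (there (there (here (inj₁ (refl , _)))))) =
      contradiction (there (there (there (here refl)))) (listed-once G D C∈ C∈ (there (there (here refl))))
    ... | there (there (there (there (here (inj₂ (refl , _)))))) =
      contradiction (there (here refl)) (listed-once G D C∈ C∈ (here refl))

  colours₄-proper : All (ProperlyColoured D colours₄) circuits
  colours₄-proper = All.tabulate coloured
    where
    by-pattern : ∀ {s y₁ y₂ ys} → (s , y₁ ∷ y₂ ∷ ys) ∈ circuits → length ys ≢ 2 →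
                 ProperlyColoured D (λ _ → colourPattern (blocks₄ (3 + length ys))) (s , y₁ ∷ y₂ ∷ ys)
    by-pattern {ys = ys} C∈ ≢2 = length-blocks₄ (length ys) ≢2 ,
      circuitWindows-proper D C∈ (colourPattern (blocks₄ (3 + length ys))) (length-blocks₄ (length ys) ≢2)
                            (colourPattern-proper (blocks₄ (3 + length ys)))

    coloured : ∀ {C} → C ∈ circuits → ProperlyColoured D colours₄ C
    coloured {s , ys} C∈ with circuit-shape G D C∈
    ... | y₁ , y₂ , y₃ ∷ y₄ ∷ [] , refl = refl ,
          ((λ ()) , inj₂ (pentagon⇒atMostTwoNeighbours C∈)) ∷ ((λ ()) , inj₁ (λ ())) ∷ ((λ ()) , inj₁ (λ ())) ∷
          ((λ ()) , inj₁ (λ ())) ∷ ((λ ()) , inj₁ (λ ())) ∷ []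
    ... | y₁ , y₂ , []            , refl = by-pattern C∈ (λ ())
    ... | y₁ , y₂ , _ ∷ []        , refl = by-pattern C∈ (λ ())
    ... | y₁ , y₂ , _ ∷ _ ∷ _ ∷ _ , refl = by-pattern C∈ (λ ())

  colours₃-proper : All (λ C → 3 ∣ length (vertices C)) circuits → All (ProperlyColoured D colours₃) circuits
  colours₃-proper divisible = All.tabulate coloured
    where
    coloured : ∀ {C} → C ∈ circuits → ProperlyColoured D colours₃ C
    coloured {s , ys} C∈ = length≡ , circuitWindows-proper D C∈ (colours₃ (s , ys)) length≡
                                                  (colourPattern-proper (replicate (suc (length ys) / 3) short))
      where
      length≡ : length (colours₃ (s , ys)) ≡ suc (length ys)
      length≡ = trans (length-colourPattern-short (suc (length ys) / 3)) (m/n*n≡m (All.lookup divisible C∈))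

decomposition⇒majIndex≤ : ∀ {n k} {G : SimpleGraph n} (D : CircuitDecomposition G) (colours : Circuit n → List (Fin (suc k))) →
                          All (ProperlyColoured D colours) (CircuitDecomposition.circuits D) → MajIndex≤ G (suc k)
decomposition⇒majIndex≤ D colours coloured =
  transitionColouring⇒majIndex≤ (windowSystem⇒transitionColouring (decomposition⇒windowSystem D colours coloured))

proposition4 : ∀ {n : ℕ} (G : SimpleGraph n) → AllDegreesEven G →
    MajIndex≤ G 4 × (Connected G → 3 ∣ numEdges G → MajIndex≤ G 3)
proposition4 G even = decomposition⇒majIndex≤ D colours₄ (colours₄-proper D) , three-colours
  where
  D : CircuitDecomposition G
  D = circuitDecomposition G even
  three-colours : Connected G → 3 ∣ numEdges G → MajIndex≤ G 3
  three-colours connected 3∣m = decomposition⇒majIndex≤ D₁ colours₃ (colours₃-proper D₁ divisible)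
    where
    D₁ : CircuitDecomposition G
    D₁ = proj₁ (connected⇒eulerian G connected even)
    divisible : All (λ C → 3 ∣ length (vertices C)) (CircuitDecomposition.circuits D₁)
    divisible = All.map (λ {C} length≡m → subst (3 ∣_) (trans (sym length≡m) (length-circuitEdges C)) 3∣m)
                        (proj₂ (connected⇒eulerian G connected even))
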